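{- Let $n\ge 1$ and let $w_0 = n(n-1)\cdots 321 \in \mathfrak{S}_n$ be the long element (in one-line notation). For $1\le k\le \lfloor n/2\rfloor$ let $B_k$ be the word $k\,(k+1)\cdots(n-k-1)\,(n-k)\,(n-k-1)\cdots(k+1)\,k$ (so $B_k = k$ when $n-k=k$), and let $a = B_1 B_2 \cdots B_{\lfloor n/2\rfloor}$, i.e. $$a = 123\cdots(n-1)\cdots321\ 234\cdots(n-2)\cdots432\ 345\cdots(n-3)\cdots543\ \cdots.$$ Then the set of reduced words of $w_0$ that are their own commutation class consists exactly of the symmetries of $a$ (namely $a$, its reverse, its complement, and its reverse complement).
   Context: $\sigma_k$ ($1\le k\le n-1$) is the simple transposition of $\mathfrak{S}_n$ swapping $k$ and $k+1$; $\ell(w)$ is the minimal number of simple transpositions whose product is $w$. A reduced word of $w$ is a word $a_1\cdots a_r$ on $\{1,\dots,n-1\}$ with $\sigma_{a_1}\cdots\sigma_{a_r}=w$ and $r=\ell(w)$. Two reduced words are commutation equivalent if related by a sequence of commutation moves $ij\leftrightarrow ji$ on adjacent letters with $|i-j|>1$; a reduced word is its own commutation class if no other reduced word is commutation equivalent to it (equivalently, adjacent letters always differ by exactly $1$). For a word $s$ on $\{1,\dots,n-1\}$: its reverse is $s$ written backwards; its complement replaces each letter $k$ by $n-k$; its reverse complement is the reverse of its complement; its symmetries are these four words. -}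

module Defs where

open import Data.Nat using (ℕ; zero; suc; _+_; _∸_; _≤_; _<_)
open import Data.Nat.DivMod using (_/_)
open import Data.List using (List; []; _∷_; _++_; map; reverse; upTo; length; concat; drop; foldl)
open import Data.List.Relation.Unary.All using (All)
open import Data.Product using (_×_)
open import Relation.Binary.PropositionalEquality using (_≡_)
open import Relation.Binary.Construct.Closure.ReflexiveTransitive using (Star)

-- A permutation of {1,…,n} is represented by its one-line notation
-- [w(1), …, w(n)] as a list of natural numbers.
OneLine : Set
OneLine = List ℕ

idPerm : ℕ → OneLine
idPerm n = map suc (upTo n)

longElement : ℕ → OneLine
longElement n = reverse (idPerm n)

-- swap the entries in positions k and k+1 (positions 1-indexed)
swapPos : ℕ → OneLine → OneLine
swapPos zero    xs           = xs
swapPos (suc zero) (x ∷ y ∷ xs) = y ∷ x ∷ xs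
swapPos (suc zero) xs        = xs
swapPos (suc (suc k)) []     = []
swapPos (suc (suc k)) (x ∷ xs) = x ∷ swapPos (suc k) xs

-- right multiplication w ↦ w σₖ swaps positions k, k+1 of the one-line
-- notation, since (w σₖ)(i) = w(σₖ(i)).
-- product σ_{a₁} σ_{a₂} ⋯ σ_{aᵣ} in one-line notation
wordProduct : ℕ → List ℕ → OneLine
wordProduct n s = foldl (λ w k → swapPos k w) (idPerm n) s

IsWord : ℕ → List ℕ → Set
IsWord n s = All (λ i → 1 ≤ i × i < n) s

ReducedWordOf : (n : ℕ) → OneLine → List ℕ → Set
ReducedWordOf n w s =
  IsWord n s × wordProduct n s ≡ w ×
  ((t : List ℕ) → IsWord n t → wordProduct n t ≡ w → length s ≤ length t)

data CommMove : List ℕ → List ℕ → Set where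
  here-lt : ∀ {i j} (xs : List ℕ) → suc (suc i) ≤ j → CommMove (i ∷ j ∷ xs) (j ∷ i ∷ xs)
  here-gt : ∀ {i j} (xs : List ℕ) → suc (suc j) ≤ i → CommMove (i ∷ j ∷ xs) (j ∷ i ∷ xs)
  there   : ∀ {xs ys} (x : ℕ) → CommMove xs ys → CommMove (x ∷ xs) (x ∷ ys)

CommEquiv : List ℕ → List ℕ → Set
CommEquiv = Star CommMove

OwnCommClass : (n : ℕ) → OneLine → List ℕ → Set
OwnCommClass n w s = (t : List ℕ) → ReducedWordOf n w t → CommEquiv s t → t ≡ s

complementW : ℕ → List ℕ → List ℕ
complementW n s = map (n ∸_) s

reverseComplementW : ℕ → List ℕ → List ℕ
reverseComplementW n s = reverse (complementW n s)

run : ℕ → ℕ → List ℕ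
run k m = map (k +_) (upTo (suc (m ∸ k)))

blockB : ℕ → ℕ → List ℕ
blockB n k = run k (n ∸ k) ++ drop 1 (reverse (run k (n ∸ k)))

wordA : ℕ → List ℕ
wordA n = concat (map (blockB n) (map suc (upTo (n / 2))))

-- A word s on {1,…,n−1} acts on the one-line notation 12⋯n by swapping positions. It is a reduced
-- word of w₀ exactly when every letter swaps an ascent, because each such swap creates one inversion
-- and w₀ has the most inversions. A reduced word is its own commutation class exactly when adjacent
-- letters differ by one, i.e. when it is a walk on the path 1 − 2 − ⋯ − (n−1).
--
-- The main work classifies the ascending walks that take a sorted list x M y to its reverse. Until
-- such a walk first reaches position 1 or n−1 it only permutes M. If it reaches 1, the minimum x can
-- only travel to the end along the unbroken run 1 2 ⋯ n−1 (a step to the left of x would trap the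
-- walk there), then the maximum y must come back along n−2 ⋯ 1, and the rest permutes M again;
-- reaching n−1 first is the mirror image, with the complementary block. So the word is X′ B Y′,
-- where X′ and Y′ are words X and Y on M shifted up by one and X followed by Y reverses M.
-- Adjacency at the two junctions with B makes X end and Y start with the same letter, so they
-- cannot both be nonempty (the second swap would undo the first). The nonempty one reverses M, so
-- by induction it is one of the four words for n − 2, and its letter at the junction says which.
-- What remains is a, its reverse, its complement and its reverse complement.

module Submission where

open import Defs
open import Data.Empty using (⊥; ⊥-elim)
open import Data.Unit using (⊤; tt)
open import Data.Nat
open import Data.Nat.Properties
open import Data.Nat.DivMod using (_/_; m/n≡1+[m∸n]/n)
open import Data.List using (List; []; _∷_; _++_; map; reverse; length; foldl; [_]; drop; concat; upTo; applyUpTo)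
open import Data.List.Properties
  using ( foldl-++; ++-assoc; ++-identityʳ; ++-cancelˡ; ++-conicalʳ; ∷-injectiveˡ; ∷-injectiveʳ
        ; ∷ʳ-injectiveˡ; ∷ʳ-injectiveʳ; length-++; length-reverse; reverse-involutive; unfold-reverse
        ; reverse-++; reverse-map; map-++; map-upTo; drop-map )
open import Data.List.Relation.Unary.All using (All; []; _∷_) renaming (map to All-map)
import Data.List.Relation.Unary.All.Properties as All
open import Data.List.Relation.Unary.AllPairs using (AllPairs; []; _∷_)
open import Data.List.Relation.Unary.Linked as Linked using (Linked; []; [-]; _∷_)
import Data.List.Relation.Unary.Linked.Properties as Linked
open import Data.List.Reverse using (Reverse; reverseView; []; _∶_∶ʳ_)
open import Data.List.Relation.Binary.Permutation.Propositional using (↭-sym)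
open import Data.List.Relation.Binary.Permutation.Propositional.Properties using (All-resp-↭; ↭-reverse)
open import Data.Product using (_×_; _,_; proj₁; proj₂; Σ-syntax; ∃-syntax)
open import Data.Sum using (_⊎_; inj₁; inj₂; [_,_]′)
import Data.Sum as Sum
open import Function using (_∘_; _⇔_; mk⇔; Equivalence)
open import Relation.Nullary using (¬_; Dec; yes; no)
open import Relation.Binary.Core using (Rel)
open import Relation.Binary.Definitions using (Symmetric; tri<; tri≈; tri>)
open import Relation.Binary.Construct.Closure.ReflexiveTransitive using (ε; _◅_)
open import Relation.Binary.PropositionalEquality hiding ([_])
open import Algebra.Properties.CommutativeSemigroup +-commutativeSemigroup using (x∙yz≈y∙xz)

infixl 4.5 _·_

_·_ : OneLine → List ℕ → OneLine
w · s = foldl (λ v k → swapPos k v) w s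

·-++ : ∀ w s t → w · (s ++ t) ≡ w · s · t
·-++ w s t = foldl-++ (λ v k → swapPos k v) w s t

-- Positions are 1-indexed as in swapPos: AscentAt k w says w(k) < w(k+1).
AscentAt : ℕ → OneLine → Set
AscentAt zero          _           = ⊥
AscentAt (suc zero)    (a ∷ b ∷ _) = a < b
AscentAt (suc zero)    _           = ⊥
AscentAt (suc (suc k)) []          = ⊥
AscentAt (suc (suc k)) (_ ∷ w)     = AscentAt (suc k) w

ascentAt? : ∀ k w → Dec (AscentAt k w)
ascentAt? zero          w           = no λ ()
ascentAt? (suc zero)    []          = no λ ()
ascentAt? (suc zero)    (a ∷ [])    = no λ ()
ascentAt? (suc zero)    (a ∷ b ∷ w) = a <? b
ascentAt? (suc (suc k)) []          = no λ ()
ascentAt? (suc (suc k)) (a ∷ w)     = ascentAt? (suc k) w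

Ascending : OneLine → List ℕ → Set
Ascending w []      = ⊤
Ascending w (k ∷ s) = AscentAt k w × Ascending (swapPos k w) s

Ascending-++⁺ : ∀ w s t → Ascending w s → Ascending (w · s) t → Ascending w (s ++ t)
Ascending-++⁺ w []      t _        q = q
Ascending-++⁺ w (k ∷ s) t (p , ps) q = p , Ascending-++⁺ (swapPos k w) s t ps q

Ascending-++⁻ : ∀ w s t → Ascending w (s ++ t) → Ascending w s × Ascending (w · s) t
Ascending-++⁻ w []      t q       = tt , q
Ascending-++⁻ w (k ∷ s) t (p , q) =
  let ps , pt = Ascending-++⁻ (swapPos k w) s t q in (p , ps) , pt

ascentAt⇒¬ascentAt-swapPos : ∀ k w → AscentAt k w → ¬ AscentAt k (swapPos k w)
ascentAt⇒¬ascentAt-swapPos (suc zero)    (a ∷ b ∷ w) a<b b<a = <-asym a<b b<a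
ascentAt⇒¬ascentAt-swapPos (suc (suc k)) (a ∷ w)     p   q   = ascentAt⇒¬ascentAt-swapPos (suc k) w p q

ascentAt⇒bounded : ∀ k w → AscentAt k w → 1 ≤ k × k < length w
ascentAt⇒bounded (suc zero)    (a ∷ b ∷ w) _ = s≤s z≤n , s≤s (s≤s z≤n)
ascentAt⇒bounded (suc (suc k)) (a ∷ w)     p = s≤s z≤n , s≤s (proj₂ (ascentAt⇒bounded (suc k) w p))

length-swapPos : ∀ k w → length (swapPos k w) ≡ length w
length-swapPos zero          w           = refl
length-swapPos (suc zero)    []          = refl
length-swapPos (suc zero)    (x ∷ [])    = refl
length-swapPos (suc zero)    (x ∷ y ∷ w) = refl
length-swapPos (suc (suc k)) []          = refl
length-swapPos (suc (suc k)) (x ∷ w)     = cong suc (length-swapPos (suc k) w)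

length-· : ∀ w s → length (w · s) ≡ length w
length-· w []      = refl
length-· w (k ∷ s) = trans (length-· (swapPos k w) s) (length-swapPos k w)

Ascending⇒IsWord : ∀ n w s → length w ≡ n → Ascending w s → IsWord n s
Ascending⇒IsWord n w []      _     _        = []
Ascending⇒IsWord n w (k ∷ s) refl (p , ps) =
  ascentAt⇒bounded k w p ∷ Ascending⇒IsWord n (swapPos k w) s (length-swapPos k w) ps

All-swapPos : ∀ {P : ℕ → Set} k w → All P w → All P (swapPos k w)
All-swapPos zero          w           p                = p
All-swapPos (suc zero)    []          p                = p
All-swapPos (suc zero)    (x ∷ [])    p                = p
All-swapPos (suc zero)    (x ∷ y ∷ w) (px ∷ py ∷ p)    = py ∷ px ∷ p
All-swapPos (suc (suc k)) []          p                = p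
All-swapPos (suc (suc k)) (x ∷ w)     (px ∷ p)         = px ∷ All-swapPos (suc k) w p

All-· : ∀ {P : ℕ → Set} w s → All P w → All P (w · s)
All-· w []      p = p
All-· w (k ∷ s) p = All-· (swapPos k w) s (All-swapPos k w p)

-- Inversions

indicator : ∀ {A : Set} → Dec A → ℕ
indicator (yes _) = 1
indicator (no _)  = 0

countBelow : ℕ → List ℕ → ℕ
countBelow x []       = 0
countBelow x (y ∷ ys) = indicator (y <? x) + countBelow x ys

inversions : OneLine → ℕ
inversions []       = 0
inversions (x ∷ xs) = countBelow x xs + inversions xs

countBelow-swapPos : ∀ x k w → countBelow x (swapPos k w) ≡ countBelow x w
countBelow-swapPos x zero          w           = refl
countBelow-swapPos x (suc zero)    []          = refl
countBelow-swapPos x (suc zero)    (a ∷ [])    = refl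
countBelow-swapPos x (suc zero)    (a ∷ b ∷ w) = x∙yz≈y∙xz (indicator (b <? x)) (indicator (a <? x)) _
countBelow-swapPos x (suc (suc k)) []          = refl
countBelow-swapPos x (suc (suc k)) (a ∷ w)     = cong (indicator (a <? x) +_) (countBelow-swapPos x (suc k) w)

inversions-swapPos-ascent : ∀ k w → AscentAt k w → inversions (swapPos k w) ≡ suc (inversions w)
inversions-swapPos-ascent (suc zero) (a ∷ b ∷ w) a<b with a <? b | b <? a
... | yes _   | no _    = cong suc (x∙yz≈y∙xz (countBelow b w) (countBelow a w) (inversions w))
... | no a≮b  | _       = ⊥-elim (a≮b a<b)
... | yes _   | yes b<a = ⊥-elim (<-asym a<b b<a)
inversions-swapPos-ascent (suc (suc k)) (a ∷ w) p =
  trans (cong₂ _+_ (countBelow-swapPos a (suc k) w) (inversions-swapPos-ascent (suc k) w p))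
        (+-suc (countBelow a w) (inversions w))

inversions-swapPos-nonAscent : ∀ k w → ¬ AscentAt k w → inversions (swapPos k w) ≤ inversions w
inversions-swapPos-nonAscent zero          w           _ = ≤-refl
inversions-swapPos-nonAscent (suc zero)    []          _ = ≤-refl
inversions-swapPos-nonAscent (suc zero)    (a ∷ [])    _ = ≤-refl
inversions-swapPos-nonAscent (suc zero)    (a ∷ b ∷ w) ¬a<b with a <? b | b <? a
... | yes a<b | _     = ⊥-elim (¬a<b a<b)
... | no _    | yes _ = ≤-trans (≤-reflexive (x∙yz≈y∙xz (countBelow b w) (countBelow a w) (inversions w))) (n≤1+n _)
... | no _    | no _  = ≤-reflexive (x∙yz≈y∙xz (countBelow b w) (countBelow a w) (inversions w))
inversions-swapPos-nonAscent (suc (suc k)) []          _ = ≤-refl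
inversions-swapPos-nonAscent (suc (suc k)) (a ∷ w)     ¬p =
  ≤-trans (≤-reflexive (cong (_+ inversions (swapPos (suc k) w)) (countBelow-swapPos a (suc k) w)))
          (+-monoʳ-≤ (countBelow a w) (inversions-swapPos-nonAscent (suc k) w ¬p))

inversions-swapPos-≤ : ∀ k w → inversions (swapPos k w) ≤ suc (inversions w)
inversions-swapPos-≤ k w with ascentAt? k w
... | yes p  = ≤-reflexive (inversions-swapPos-ascent k w p)
... | no ¬p  = m≤n⇒m≤1+n (inversions-swapPos-nonAscent k w ¬p)

inversions-·-≤ : ∀ w s → inversions (w · s) ≤ length s + inversions w
inversions-·-≤ w []      = ≤-refl
inversions-·-≤ w (k ∷ s) = begin
  inversions (swapPos k w · s)          ≤⟨ inversions-·-≤ (swapPos k w) s ⟩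
  length s + inversions (swapPos k w)   ≤⟨ +-monoʳ-≤ (length s) (inversions-swapPos-≤ k w) ⟩
  length s + suc (inversions w)         ≡⟨ +-suc (length s) (inversions w) ⟩
  suc (length s) + inversions w         ∎
  where open ≤-Reasoning

inversions-·-Ascending : ∀ w s → Ascending w s → inversions (w · s) ≡ length s + inversions w
inversions-·-Ascending w []      _        = refl
inversions-·-Ascending w (k ∷ s) (p , ps) = begin
  inversions (swapPos k w · s)          ≡⟨ inversions-·-Ascending (swapPos k w) s ps ⟩
  length s + inversions (swapPos k w)   ≡⟨ cong (length s +_) (inversions-swapPos-ascent k w p) ⟩
  length s + suc (inversions w)         ≡⟨ +-suc (length s) (inversions w) ⟩
  suc (length s) + inversions w         ∎
  where open ≡-Reasoning

Ascending-fromInversions : ∀ w s → length s + inversions w ≤ inversions (w · s) → Ascending w s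
Ascending-fromInversions w []      _ = tt
Ascending-fromInversions w (k ∷ s) le with ascentAt? k w
... | yes p  = p , Ascending-fromInversions (swapPos k w) s (begin
  length s + inversions (swapPos k w)   ≡⟨ cong (length s +_) (inversions-swapPos-ascent k w p) ⟩
  length s + suc (inversions w)         ≡⟨ +-suc (length s) (inversions w) ⟩
  suc (length s) + inversions w         ≤⟨ le ⟩
  inversions (swapPos k w · s)          ∎)
  where open ≤-Reasoning
... | no ¬p = ⊥-elim (<-irrefl refl (begin-strict
  suc (length s) + inversions w         ≤⟨ le ⟩
  inversions (swapPos k w · s)          ≤⟨ inversions-·-≤ (swapPos k w) s ⟩
  length s + inversions (swapPos k w)   ≤⟨ +-monoʳ-≤ (length s) (inversions-swapPos-nonAscent k w ¬p) ⟩
  length s + inversions w               <⟨ n<1+n _ ⟩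
  suc (length s) + inversions w         ∎))
  where open ≤-Reasoning

Ascending⇒shortest : ∀ w s t → Ascending w s → w · t ≡ w · s → length s ≤ length t
Ascending⇒shortest w s t as eq = +-cancelʳ-≤ (inversions w) (length s) (length t) (begin
  length s + inversions w   ≡⟨ inversions-·-Ascending w s as ⟨
  inversions (w · s)        ≡⟨ cong inversions eq ⟨
  inversions (w · t)        ≤⟨ inversions-·-≤ w t ⟩
  length t + inversions w   ∎)
  where open ≤-Reasoning

shortest⇒Ascending : ∀ w s s₀ → Ascending w s₀ → w · s ≡ w · s₀ → length s ≤ length s₀ → Ascending w s
shortest⇒Ascending w s s₀ as₀ eq le = Ascending-fromInversions w s (begin
  length s + inversions w   ≤⟨ +-monoˡ-≤ (inversions w) le ⟩
  length s₀ + inversions w  ≡⟨ inversions-·-Ascending w s₀ as₀ ⟨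
  inversions (w · s₀)       ≡⟨ cong inversions eq ⟨
  inversions (w · s)        ∎)
  where open ≤-Reasoning

length-∷ʳ : ∀ (xs : List ℕ) x → length (xs ++ [ x ]) ≡ suc (length xs)
length-∷ʳ xs x = trans (length-++ xs) (+-comm (length xs) 1)

All-reverse : ∀ {P : ℕ → Set} xs → All P xs → All P (reverse xs)
All-reverse xs = All-resp-↭ (↭-sym (↭-reverse xs))

swapPos-middle : ∀ P a b R → swapPos (suc (length P)) (P ++ a ∷ b ∷ R) ≡ P ++ b ∷ a ∷ R
swapPos-middle []      a b R = refl
swapPos-middle (p ∷ P) a b R = cong (p ∷_) (swapPos-middle P a b R)

ascentAt-middle : ∀ P a b R → a < b → AscentAt (suc (length P)) (P ++ a ∷ b ∷ R)
ascentAt-middle []      a b R a<b = a<b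
ascentAt-middle (p ∷ P) a b R a<b = ascentAt-middle P a b R a<b

swapPos-++ˡ : ∀ k P R → k < length P → swapPos k (P ++ R) ≡ swapPos k P ++ R
swapPos-++ˡ zero          P           R _         = refl
swapPos-++ˡ (suc zero)    (p ∷ q ∷ P) R _         = refl
swapPos-++ˡ (suc zero)    (p ∷ [])    R (s≤s ())
swapPos-++ˡ (suc (suc k)) (p ∷ P)     R (s≤s lt) = cong (p ∷_) (swapPos-++ˡ (suc k) P R lt)

ascentAt-++ˡ⁺ : ∀ k P R → AscentAt k P → AscentAt k (P ++ R)
ascentAt-++ˡ⁺ (suc zero)    (p ∷ q ∷ P) R a = a
ascentAt-++ˡ⁺ (suc (suc k)) (p ∷ P)     R a = ascentAt-++ˡ⁺ (suc k) P R a

ascentAt-++ˡ⁻ : ∀ k P R → k < length P → AscentAt k (P ++ R) → AscentAt k P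
ascentAt-++ˡ⁻ (suc zero)    (p ∷ q ∷ P) R _         a = a
ascentAt-++ˡ⁻ (suc zero)    (p ∷ [])    R (s≤s ()) a
ascentAt-++ˡ⁻ (suc (suc k)) (p ∷ P)     R (s≤s lt) a = ascentAt-++ˡ⁻ (suc k) P R lt a

swapPos-++ʳ : ∀ A y k Q → swapPos (suc (length A + suc k)) (A ++ y ∷ Q) ≡ A ++ y ∷ swapPos (suc k) Q
swapPos-++ʳ []      y k Q = refl
swapPos-++ʳ (a ∷ A) y k Q = cong (a ∷_) (swapPos-++ʳ A y k Q)

¬ascentAt-before-min : ∀ x P Q → All (x <_) P → ¬ AscentAt (length P) (P ++ x ∷ Q)
¬ascentAt-before-min x (p ∷ [])     Q (x<p ∷ _) a = <-asym x<p a
¬ascentAt-before-min x (p ∷ q ∷ P) Q (_ ∷ x<P) a = ¬ascentAt-before-min x (q ∷ P) Q x<P a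

¬ascentAt-after-max : ∀ y A Q → All (_< y) Q → ¬ AscentAt (suc (length A)) (A ++ y ∷ Q)
¬ascentAt-after-max y []           (q ∷ Q) (q<y ∷ _) a = <-asym q<y a
¬ascentAt-after-max y (a₀ ∷ [])     Q       Q<y       a = ¬ascentAt-after-max y [] Q Q<y a
¬ascentAt-after-max y (a₀ ∷ a₁ ∷ A) Q       Q<y       a = ¬ascentAt-after-max y (a₁ ∷ A) Q Q<y a

ascentAt-∷ʳ-inside : ∀ k N x → AscentAt k (N ++ [ x ]) → k ≢ length N → k < length N
ascentAt-∷ʳ-inside k N x asc k≢ =
  ≤∧≢⇒< (s≤s⁻¹ (subst (k <_) (length-∷ʳ N x) (proj₂ (ascentAt⇒bounded k (N ++ [ x ]) asc)))) k≢

IsWord-last : ∀ {k} X z → IsWord k (X ++ [ z ]) → z < k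
IsWord-last X z w = proj₂ (proj₂ (All.∷ʳ⁻ w))

shift : List ℕ → List ℕ
shift = map suc

shift-· : ∀ x w Y → Ascending w Y → (x ∷ w) · shift Y ≡ x ∷ (w · Y)
shift-· x w []            _        = refl
shift-· x w (suc k ∷ Y) (_ , ps) = shift-· x (swapPos (suc k) w) Y ps

Ascending-shift : ∀ x w Y → Ascending w Y → Ascending (x ∷ w) (shift Y)
Ascending-shift x w []          _        = tt
Ascending-shift x w (suc k ∷ Y) (p , ps) = p , Ascending-shift x (swapPos (suc k) w) Y ps

padRight-· : ∀ w R Y → Ascending w Y → (w ++ R) · Y ≡ (w · Y) ++ R
padRight-· w R []      _        = refl
padRight-· w R (k ∷ Y) (p , ps) =
  trans (cong (_· Y) (swapPos-++ˡ k w R (proj₂ (ascentAt⇒bounded k w p))))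
        (padRight-· (swapPos k w) R Y ps)

Ascending-padRight : ∀ w R Y → Ascending w Y → Ascending (w ++ R) Y
Ascending-padRight w R []      _        = tt
Ascending-padRight w R (k ∷ Y) (p , ps) =
  ascentAt-++ˡ⁺ k w R p ,
  subst (λ v → Ascending v Y) (sym (swapPos-++ˡ k w R (proj₂ (ascentAt⇒bounded k w p))))
        (Ascending-padRight (swapPos k w) R Y ps)

infix 4 _─[_]→_

record _─[_]→_ (w : OneLine) (s : List ℕ) (v : OneLine) : Set where
  constructor _,_
  field
    ascending : Ascending w s
    arrives   : w · s ≡ v

open _─[_]→_ using (ascending)

─→-∷ : ∀ {w v k s} → AscentAt k w → swapPos k w ─[ s ]→ v → w ─[ k ∷ s ]→ v
─→-∷ p (ps , eq) = (p , ps) , eq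

─→-++ : ∀ {w u v s t} → w ─[ s ]→ u → u ─[ t ]→ v → w ─[ s ++ t ]→ v
─→-++ {w} {s = s} {t} (as , refl) (at , refl) = Ascending-++⁺ w s t as at , ·-++ w s t

─→-++⁻ : ∀ {w v} s t → w ─[ s ++ t ]→ v → w ─[ s ]→ w · s × w · s ─[ t ]→ v
─→-++⁻ {w} s t (ast , eq) =
  let as , at = Ascending-++⁻ w s t ast in (as , refl) , at , trans (sym (·-++ w s t)) eq

─→-after : ∀ {w u v s t} → w ─[ s ]→ u → w ─[ s ++ t ]→ v → u ─[ t ]→ v
─→-after {s = s} {t} (_ , refl) p = proj₂ (─→-++⁻ s t p)

─→-cong : ∀ {w w′ v v′ s} → w ≡ w′ → v ≡ v′ → w ─[ s ]→ v → w′ ─[ s ]→ v′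
─→-cong refl refl p = p

─→-shift : ∀ {w v} x Y → w ─[ Y ]→ v → x ∷ w ─[ shift Y ]→ x ∷ v
─→-shift {w} x Y (as , refl) = Ascending-shift x w Y as , shift-· x w Y as

─→-padRight : ∀ {w v} R Y → w ─[ Y ]→ v → w ++ R ─[ Y ]→ v ++ R
─→-padRight {w} R Y (as , refl) = Ascending-padRight w R Y as , padRight-· w R Y as

last-letter-not-ascent : ∀ {M N} X z → M ─[ X ++ [ z ] ]→ N → ¬ AscentAt z N
last-letter-not-ascent {M} X z p asc with ─→-++⁻ X [ z ] p
... | _ , ((a , _) , eq) = ascentAt⇒¬ascentAt-swapPos z (M · X) a (subst (AscentAt z) (sym eq) asc)

path-IsWord : ∀ {M N} Y → M ─[ Y ]→ N → IsWord (length M) Y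
path-IsWord {M} Y p = Ascending⇒IsWord (length M) M Y refl (ascending p)

length-path : ∀ {M N Y} → M ─[ Y ]→ N → length N ≡ length M
length-path {M} {Y = Y} (_ , refl) = length-· M Y

ascRun : ℕ → ℕ → List ℕ
ascRun i zero    = []
ascRun i (suc l) = i ∷ ascRun (suc i) l

descRun : ℕ → List ℕ
descRun zero    = []
descRun (suc j) = suc j ∷ descRun j

ascRun-∷ʳ : ∀ i l → ascRun i (suc l) ≡ ascRun i l ++ [ i + l ]
ascRun-∷ʳ i zero    = cong [_] (sym (+-identityʳ i))
ascRun-∷ʳ i (suc l) = cong (i ∷_) (trans (ascRun-∷ʳ (suc i) l) (cong (λ m → ascRun (suc i) l ++ [ m ]) (sym (+-suc i l))))

descRun-∷ʳ : ∀ j → descRun (suc j) ≡ shift (descRun j) ++ [ 1 ]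
descRun-∷ʳ zero    = refl
descRun-∷ʳ (suc j) = cong (suc (suc j) ∷_) (descRun-∷ʳ j)

shift-ascRun : ∀ i l → shift (ascRun i l) ≡ ascRun (suc i) l
shift-ascRun i zero    = refl
shift-ascRun i (suc l) = cong (suc i ∷_) (shift-ascRun (suc i) l)

reverse-ascRun : ∀ l → reverse (ascRun 1 l) ≡ descRun l
reverse-ascRun zero    = refl
reverse-ascRun (suc l) = begin
  reverse (ascRun 1 (suc l))           ≡⟨ cong reverse (ascRun-∷ʳ 1 l) ⟩
  reverse (ascRun 1 l ++ [ suc l ])    ≡⟨ reverse-++ (ascRun 1 l) [ suc l ] ⟩
  suc l ∷ reverse (ascRun 1 l)         ≡⟨ cong (suc l ∷_) (reverse-ascRun l) ⟩
  descRun (suc l)                      ∎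
  where open ≡-Reasoning

Sorted : List ℕ → Set
Sorted = AllPairs _<_

ascRun-> : ∀ i l → All (i <_) (ascRun (suc i) l)
ascRun-> i zero    = []
ascRun-> i (suc l) = n<1+n i ∷ All-map (<-trans (n<1+n i)) (ascRun-> (suc i) l)

ascRun-sorted : ∀ i l → Sorted (ascRun i l)
ascRun-sorted i zero    = []
ascRun-sorted i (suc l) = ascRun-> i l ∷ ascRun-sorted (suc i) l

length-ascRun : ∀ i l → length (ascRun i l) ≡ l
length-ascRun i zero    = refl
length-ascRun i (suc l) = cong suc (length-ascRun (suc i) l)

ascRun-carries-right : ∀ P x Q → All (x <_) Q →
  P ++ x ∷ Q ─[ ascRun (suc (length P)) (length Q) ]→ P ++ Q ++ [ x ]
ascRun-carries-right P x Q x<Q = go P Q refl x<Q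
  where
  go : ∀ {i} P Q → length P ≡ i → All (x <_) Q → P ++ x ∷ Q ─[ ascRun (suc i) (length Q) ]→ P ++ Q ++ [ x ]
  go P []      refl _           = tt , refl
  go P (q ∷ Q) refl (x<q ∷ x<Q) =
    ─→-∷ (ascentAt-middle P x q Q x<q)
      (─→-cong (trans (++-assoc P [ q ] (x ∷ Q)) (sym (swapPos-middle P x q Q))) (++-assoc P [ q ] (Q ++ [ x ]))
        (go (P ++ [ q ]) Q (length-∷ʳ P q) x<Q))

descRun-carries-left : ∀ A y Q → All (_< y) A → A ++ y ∷ Q ─[ descRun (length A) ]→ y ∷ A ++ Q
descRun-carries-left A y Q = go (reverseView A) Q
  where
  go : ∀ {A} → Reverse A → ∀ Q → All (_< y) A → A ++ y ∷ Q ─[ descRun (length A) ]→ y ∷ A ++ Q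
  go []              Q _   = tt , refl
  go (A ∶ rA ∶ʳ a) Q A<y
    rewrite length-∷ʳ A a | ++-assoc A [ a ] (y ∷ Q) | ++-assoc A [ a ] Q =
    let A<y , a<y = All.∷ʳ⁻ A<y in
    ─→-∷ (ascentAt-middle A a y Q a<y)
      (─→-cong (sym (swapPos-middle A a y Q)) refl (go rA (a ∷ Q) A<y))

-- Walks

module _ {ℓ} {R : Rel ℕ ℓ} where

  Linked-++⁻ˡ : ∀ xs {ys} → Linked R (xs ++ ys) → Linked R xs
  Linked-++⁻ˡ []           _            = []
  Linked-++⁻ˡ (x ∷ [])     _            = [-]
  Linked-++⁻ˡ (x ∷ y ∷ xs) (r ∷ rs)     = r ∷ Linked-++⁻ˡ (y ∷ xs) rs

  Linked-++⁻ʳ : ∀ xs {ys} → Linked R (xs ++ ys) → Linked R ys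
  Linked-++⁻ʳ []       rs = rs
  Linked-++⁻ʳ (x ∷ xs) rs = Linked-++⁻ʳ xs (Linked.tail rs)

  Linked-middle : ∀ xs {u v ys} → Linked R (xs ++ u ∷ v ∷ ys) → R u v
  Linked-middle xs rs = Linked.head (Linked-++⁻ʳ xs rs)

  Linked-glue : ∀ xs a ys → Linked R (xs ++ [ a ]) → Linked R (a ∷ ys) → Linked R ((xs ++ [ a ]) ++ ys)
  Linked-glue []           a ys _          rs = rs
  Linked-glue (x ∷ [])     a ys (r ∷ [-]) rs = r ∷ rs
  Linked-glue (x ∷ y ∷ xs) a ys (r ∷ rxs) rs = r ∷ Linked-glue (y ∷ xs) a ys rxs rs

  Linked-reverse : Symmetric R → ∀ xs → Linked R xs → Linked R (reverse xs)
  Linked-reverse R-sym []           _        = []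
  Linked-reverse R-sym (x ∷ [])     _        = [-]
  Linked-reverse R-sym (x ∷ y ∷ xs) (r ∷ rs) =
    subst (Linked R) (trans (cong (_++ [ x ]) (sym (unfold-reverse y xs))) (sym (unfold-reverse x (y ∷ xs))))
      (Linked-glue (reverse xs) y [ x ]
        (subst (Linked R) (unfold-reverse y xs) (Linked-reverse R-sym (y ∷ xs) rs)) (R-sym r ∷ [-]))

  Linked-fromPairs : ∀ s → (∀ L i j T → s ≡ L ++ i ∷ j ∷ T → R i j) → Linked R s
  Linked-fromPairs []          _ = []
  Linked-fromPairs (u ∷ [])    _ = [-]
  Linked-fromPairs (u ∷ v ∷ s) f =
    f [] u v s refl ∷ Linked-fromPairs (v ∷ s) (λ L i j T e → f (u ∷ L) i j T (cong (u ∷_) e))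

Adjacent : ℕ → ℕ → Set
Adjacent a b = suc a ≡ b ⊎ suc b ≡ a

Adjacent-sym : Symmetric Adjacent
Adjacent-sym (inj₁ e) = inj₂ e
Adjacent-sym (inj₂ e) = inj₁ e

Walk : List ℕ → Set
Walk = Linked Adjacent

Walk-shift⁺ : ∀ {Y} → Walk Y → Walk (shift Y)
Walk-shift⁺ w = Linked.map⁺ (Linked.map (Sum.map (cong suc) (cong suc)) w)

Walk-shift⁻ : ∀ {Y} → Walk (shift Y) → Walk Y
Walk-shift⁻ w = Linked.map (Sum.map suc-injective suc-injective) (Linked.map⁻ w)

HeadAtMost : ℕ → List ℕ → Set
HeadAtMost b []      = ⊤
HeadAtMost b (h ∷ _) = h ≤ b

HeadAtLeast : ℕ → List ℕ → Set
HeadAtLeast b []      = ⊤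
HeadAtLeast b (h ∷ _) = b ≤ h

Walk⇒HeadAtMost : ∀ u s → Walk (u ∷ s) → HeadAtMost (suc u) s
Walk⇒HeadAtMost u []      _                = tt
Walk⇒HeadAtMost u (v ∷ s) (inj₁ refl ∷ _) = ≤-refl
Walk⇒HeadAtMost u (v ∷ s) (inj₂ refl ∷ _) = ≤-trans (n≤1+n v) (n≤1+n (suc v))

Walk⇒HeadAtLeast : ∀ u s → Walk (suc u ∷ s) → HeadAtLeast u s
Walk⇒HeadAtLeast u []      _                = tt
Walk⇒HeadAtLeast u (v ∷ s) (inj₁ refl ∷ _) = ≤-trans (n≤1+n u) (n≤1+n (suc u))
Walk⇒HeadAtLeast u (v ∷ s) (inj₂ refl ∷ _) = ≤-refl

Walk-between : ∀ A a c B → Walk ((A ++ [ a ]) ++ c ∷ B) → Adjacent a c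
Walk-between A a c B walk = Linked-middle A (subst Walk (++-assoc A [ a ] (c ∷ B)) walk)

Walk-ascRun : ∀ i l → Walk (i ∷ ascRun (suc i) l)
Walk-ascRun i zero    = [-]
Walk-ascRun i (suc l) = inj₁ refl ∷ Walk-ascRun (suc i) l

Walk-descRun : ∀ j → Walk (suc j ∷ descRun j)
Walk-descRun zero    = [-]
Walk-descRun (suc j) = inj₂ refl ∷ Walk-descRun j

Walk-after-ascRun : ∀ i l r → Walk (ascRun i (suc l) ++ r) → Walk (i + l ∷ r)
Walk-after-ascRun i l r walk =
  Linked-++⁻ʳ (ascRun i l) (subst Walk (trans (cong (_++ r) (ascRun-∷ʳ i l)) (++-assoc (ascRun i l) _ r)) walk)

Walk-after-descRun : ∀ j r → Walk (descRun (suc j) ++ r) → Walk (1 ∷ r)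
Walk-after-descRun j r walk =
  Linked-++⁻ʳ (shift (descRun j)) (subst Walk (trans (cong (_++ r) (descRun-∷ʳ j)) (++-assoc (shift (descRun j)) _ r)) walk)

minimum-not-last : ∀ Z x R Z′ → All (x <_) R → R ≢ [] → Z ++ x ∷ R ≢ Z′ ++ [ x ]
minimum-not-last Z x R Z′ x<R R≢[] eq with reverseView R
... | []            = R≢[] refl
... | R′ ∶ _ ∶ʳ r =
  <-irrefl (sym (∷ʳ-injectiveʳ (Z ++ x ∷ R′) Z′ (trans (++-assoc Z (x ∷ R′) [ r ]) eq))) (proj₂ (All.∷ʳ⁻ x<R))

∷ʳ≢[] : ∀ (A : List ℕ) {a} → A ++ [ a ] ≢ []
∷ʳ≢[] []      ()
∷ʳ≢[] (_ ∷ _) ()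

maximum-not-first : ∀ A y Z Z′ → All (_< y) A → A ≢ [] → A ++ y ∷ Z ≢ y ∷ Z′
maximum-not-first []      y Z Z′ _          A≢[] _  = A≢[] refl
maximum-not-first (a ∷ A) y Z Z′ (a<y ∷ _) _    eq = <-irrefl (∷-injectiveˡ eq) a<y

minimum-stays : ∀ P x Q r → All (x <_) P → Walk r → HeadAtMost (length P) r →
  Ascending (P ++ x ∷ Q) r → (P ++ x ∷ Q) · r ≡ (P · r) ++ x ∷ Q
minimum-stays P x Q []      _   _    _   _           = refl
minimum-stays P x Q (h ∷ r) x<P walk h≤P (asc , ascs) with m≤n⇒m<n∨m≡n h≤P
... | inj₂ refl = ⊥-elim (¬ascentAt-before-min x P Q x<P asc)
... | inj₁ h<P rewrite swapPos-++ˡ h P (x ∷ Q) h<P =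
  minimum-stays (swapPos h P) x Q r (All-swapPos h P x<P) (Linked.tail walk)
    (head-bound r (Walk⇒HeadAtMost h r walk)) ascs
  where
  head-bound : ∀ r → HeadAtMost (suc h) r → HeadAtMost (length (swapPos h P)) r
  head-bound []      _ = tt
  head-bound (_ ∷ _) p = ≤-trans p (subst (suc h ≤_) (sym (length-swapPos h P)) h<P)

maximum-stays : ∀ A y Q r → All (_< y) Q → Walk r → HeadAtLeast (suc (length A)) r →
  Ascending (A ++ y ∷ Q) r → ∃[ Z ] (A ++ y ∷ Q) · r ≡ A ++ y ∷ Z
maximum-stays A y Q []      _   _    _   _           = Q , refl
maximum-stays A y Q (h ∷ r) Q<y walk A<h (asc , ascs) with m≤n⇒m<n∨m≡n A<h
... | inj₂ refl = ⊥-elim (¬ascentAt-after-max y A Q Q<y asc)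
-- Write h = |A| + k + 2, a position inside Q.
... | inj₁ A<h′ with h ∸ suc (suc (length A)) | m+[n∸m]≡n A<h′
...   | k | refl rewrite sym (+-suc (length A) k) | swapPos-++ʳ A y k Q =
  maximum-stays A y (swapPos (suc k) Q) r (All-swapPos (suc k) Q Q<y) (Linked.tail walk)
    (head-bound r (Walk⇒HeadAtLeast (length A + suc k) r walk)) ascs
  where
  head-bound : ∀ r → HeadAtLeast (length A + suc k) r → HeadAtLeast (suc (length A)) r
  head-bound []      _ = tt
  head-bound (_ ∷ _) p = ≤-trans (≤-trans (s≤s (m≤m+n (length A) k)) (≤-reflexive (sym (+-suc (length A) k)))) p

ascRun-forced : ∀ P x Q r Z → All (x <_) P → All (x <_) Q → Walk r → HeadAtMost (suc (length P)) r →
  P ++ x ∷ Q ─[ r ]→ Z ++ [ x ] →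
  Σ[ r′ ∈ List ℕ ] r ≡ ascRun (suc (length P)) (length Q) ++ r′ × P ++ Q ++ [ x ] ─[ r′ ]→ Z ++ [ x ]
ascRun-forced P x Q r Z x<P x<Q walk hd path with go P Q r refl x<P x<Q walk hd path
  where
  go : ∀ {i} P Q r → length P ≡ i → All (x <_) P → All (x <_) Q → Walk r → HeadAtMost (suc i) r →
    P ++ x ∷ Q ─[ r ]→ Z ++ [ x ] → ∃[ r′ ] r ≡ ascRun (suc i) (length Q) ++ r′
  go P []      r       refl _   _   _    _  _        = r , refl
  go P (q ∷ Q) []      refl _   x<Q _    _  (_ , eq) = ⊥-elim (minimum-not-last P x (q ∷ Q) Z x<Q (λ ()) eq)
  go P (q ∷ Q) (h ∷ r) refl x<P x<Q walk h≤ ((asc , ascs) , eq) with m≤n⇒m<n∨m≡n h≤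
  ... | inj₁ (s≤s h≤P) = ⊥-elim (minimum-not-last (P · (h ∷ r)) x (q ∷ Q) Z x<Q (λ ())
          (trans (sym (minimum-stays P x (q ∷ Q) (h ∷ r) x<P walk h≤P (asc , ascs))) eq))
  ... | inj₂ refl with x<Q
  ...   | x<q ∷ x<Q′ =
    let moved = trans (swapPos-middle P x q Q) (sym (++-assoc P [ q ] (x ∷ Q)))
        r′ , r≡ = go (P ++ [ q ]) Q r (length-∷ʳ P q) (All.∷ʳ⁺ x<P x<q) x<Q′ (Linked.tail walk)
                    (Walk⇒HeadAtMost h r walk) (─→-cong moved refl (ascs , eq))
    in r′ , cong (h ∷_) r≡
... | r′ , refl = r′ , refl , ─→-after (ascRun-carries-right P x Q x<Q) path

descRun-forced : ∀ A y Q r Z → All (_< y) A → All (_< y) Q → Walk r → HeadAtLeast (length A) r →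
  A ++ y ∷ Q ─[ r ]→ y ∷ Z → Σ[ r′ ∈ List ℕ ] r ≡ descRun (length A) ++ r′ × y ∷ A ++ Q ─[ r′ ]→ y ∷ Z
descRun-forced A y Q r Z A<y Q<y walk hd path with go (reverseView A) Q r A<y Q<y walk hd path
  where
  go : ∀ {A} → Reverse A → ∀ Q r → All (_< y) A → All (_< y) Q → Walk r → HeadAtLeast (length A) r →
    A ++ y ∷ Q ─[ r ]→ y ∷ Z → ∃[ r′ ] r ≡ descRun (length A) ++ r′
  go []            Q r       _   _   _    _  _ = r , refl
  go (A ∶ rA ∶ʳ a) Q []      A<y _   _    _  (_ , eq) =
    ⊥-elim (maximum-not-first (A ++ [ a ]) y Q Z A<y (∷ʳ≢[] A) eq)
  go (A ∶ rA ∶ʳ a) Q (h ∷ r) A<y Q<y walk hd ((asc , ascs) , eq)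
    with m≤n⇒m<n∨m≡n (subst (_≤ h) (length-∷ʳ A a) hd)
  ... | inj₁ L<h =
    let Z″ , stays = maximum-stays (A ++ [ a ]) y Q (h ∷ r) Q<y walk
                       (subst (λ m → suc m ≤ h) (sym (length-∷ʳ A a)) L<h) (asc , ascs)
    in ⊥-elim (maximum-not-first (A ++ [ a ]) y Z″ Z A<y (∷ʳ≢[] A) (trans (sym stays) eq))
  ... | inj₂ refl =
    let A<y′ , a<y = All.∷ʳ⁻ A<y
        moved = trans (cong (swapPos h) (++-assoc A [ a ] (y ∷ Q))) (swapPos-middle A a y Q)
        r′ , r≡ = go rA (a ∷ Q) r A<y′ (a<y ∷ Q<y) (Linked.tail walk) (Walk⇒HeadAtLeast (length A) r walk)
                    (─→-cong moved refl (ascs , eq))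
    in subst (λ m → ∃[ r′ ] h ∷ r ≡ descRun m ++ r′) (sym (length-∷ʳ A a)) (r′ , cong (h ∷_) r≡)
... | r′ , refl = r′ , refl , ─→-after (descRun-carries-left A y Q A<y) path

-- Nested words

-- peak k is the block B₁ of the statement for n = k + 2, and valley k is its complement.
peak : ℕ → List ℕ
peak k = ascRun 1 (suc k) ++ descRun k

valley : ℕ → List ℕ
valley k = descRun (suc k) ++ ascRun 2 k

SwapsEnds : (ℕ → List ℕ) → Set
SwapsEnds b = ∀ x M y → x < y → All (x <_) M → All (_< y) M → x ∷ M ++ [ y ] ─[ b (length M) ]→ y ∷ M ++ [ x ]

peak-swapsEnds : SwapsEnds peak
peak-swapsEnds x M y x<y x<M M<y =
  ─→-++ (─→-cong refl (++-assoc M [ y ] [ x ])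
          (subst (λ m → x ∷ M ++ [ y ] ─[ ascRun 1 m ]→ (M ++ [ y ]) ++ [ x ]) (length-∷ʳ M y)
            (ascRun-carries-right [] x (M ++ [ y ]) (All.∷ʳ⁺ x<M x<y))))
        (descRun-carries-left M y [ x ] M<y)

valley-swapsEnds : SwapsEnds valley
valley-swapsEnds x M y x<y x<M M<y =
  ─→-++ (─→-cong refl (cong (λ Z → y ∷ x ∷ Z) (++-identityʳ M)) (descRun-carries-left (x ∷ M) y [] (x<y ∷ M<y)))
        (ascRun-carries-right [ y ] x M x<M)

peak-closes : ∀ k → Σ[ B ∈ List ℕ ] peak k ≡ B ++ [ 1 ]
peak-closes zero    = [] , refl
peak-closes (suc k) = ascRun 1 (2 + k) ++ shift (descRun k) ,
  trans (cong (ascRun 1 (2 + k) ++_) (descRun-∷ʳ k)) (sym (++-assoc (ascRun 1 (2 + k)) _ [ 1 ]))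

valley-closes : ∀ k → Σ[ B ∈ List ℕ ] valley k ≡ B ++ [ suc k ]
valley-closes zero    = [] , refl
valley-closes (suc k) = descRun (2 + k) ++ ascRun 2 k ,
  trans (cong (descRun (2 + k) ++_) (ascRun-∷ʳ 2 k)) (sym (++-assoc (descRun (2 + k)) _ [ 2 + k ]))

prefixNest : (ℕ → List ℕ) → ℕ → List ℕ
prefixNest b zero          = []
prefixNest b (suc zero)    = []
prefixNest b (suc (suc k)) = b k ++ shift (prefixNest b k)

suffixNest : (ℕ → List ℕ) → ℕ → List ℕ
suffixNest b zero          = []
suffixNest b (suc zero)    = []
suffixNest b (suc (suc k)) = shift (suffixNest b k) ++ b k

record SortedEnds (x : ℕ) (M : List ℕ) (y : ℕ) : Set where
  field
    x<y     : x < y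
    x<M     : All (x <_) M
    M<y     : All (_< y) M
    sortedM : Sorted M

sortedEnds : ∀ x M y → Sorted (x ∷ M ++ [ y ]) → SortedEnds x M y
sortedEnds x M y (x<My ∷ sortedMy) = record
  { x<y = proj₂ (All.∷ʳ⁻ x<My) ; x<M = proj₁ (All.∷ʳ⁻ x<My)
  ; M<y = proj₂ (sorted-∷ʳ M sortedMy) ; sortedM = proj₁ (sorted-∷ʳ M sortedMy) }
  where
  sorted-∷ʳ : ∀ M → Sorted (M ++ [ y ]) → Sorted M × All (_< y) M
  sorted-∷ʳ []      _               = [] , []
  sorted-∷ʳ (m ∷ M) (m<My ∷ sorted) =
    let sortedM , M<y = sorted-∷ʳ M sorted
        m<M , m<y = All.∷ʳ⁻ m<My
    in (m<M ∷ sortedM) , (m<y ∷ M<y)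

splitEnds : ∀ k l → length l ≡ suc (suc k) →
  Σ[ x ∈ ℕ ] Σ[ M ∈ List ℕ ] Σ[ y ∈ ℕ ] l ≡ x ∷ M ++ [ y ] × length M ≡ k
splitEnds k (x ∷ t) len with reverseView t
... | M ∶ _ ∶ʳ y = x , M , y , refl , suc-injective (trans (sym (length-∷ʳ M y)) (suc-injective len))

reverse-ends : ∀ (x : ℕ) M y → reverse (x ∷ M ++ [ y ]) ≡ y ∷ reverse M ++ [ x ]
reverse-ends x M y = trans (unfold-reverse x (M ++ [ y ])) (cong (_++ [ x ]) (reverse-++ M [ y ]))

prefix-reverses : ∀ {x M y blk s} → x ∷ M ++ [ y ] ─[ blk ]→ y ∷ M ++ [ x ] → M ─[ s ]→ reverse M →
  x ∷ M ++ [ y ] ─[ blk ++ shift s ]→ reverse (x ∷ M ++ [ y ])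
prefix-reverses {x} {M} {y} {s = s} swap inner =
  ─→-++ swap (─→-cong refl (sym (reverse-ends x M y)) (─→-shift y s (─→-padRight [ x ] s inner)))

suffix-reverses : ∀ {x M y blk s} → M ─[ s ]→ reverse M → x ∷ reverse M ++ [ y ] ─[ blk ]→ y ∷ reverse M ++ [ x ] →
  x ∷ M ++ [ y ] ─[ shift s ++ blk ]→ reverse (x ∷ M ++ [ y ])
suffix-reverses {x} {M} {y} {s = s} inner swap =
  ─→-++ (─→-shift x s (─→-padRight [ y ] s inner)) (─→-cong refl (sym (reverse-ends x M y)) swap)

module _ {b : ℕ → List ℕ} (swaps : SwapsEnds b) where

  prefixNest-reverses : ∀ n l → length l ≡ n → Sorted l → l ─[ prefixNest b n ]→ reverse l
  prefixNest-reverses zero          [] refl _ = tt , refl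
  prefixNest-reverses (suc zero)    (_ ∷ []) refl _ = tt , refl
  prefixNest-reverses (suc (suc k)) l len sorted with splitEnds k l len
  ... | x , M , y , refl , refl =
    let open SortedEnds (sortedEnds x M y sorted) in
    prefix-reverses (swaps x M y x<y x<M M<y) (prefixNest-reverses k M refl sortedM)

  suffixNest-reverses : ∀ n l → length l ≡ n → Sorted l → l ─[ suffixNest b n ]→ reverse l
  suffixNest-reverses zero          [] refl _ = tt , refl
  suffixNest-reverses (suc zero)    (_ ∷ []) refl _ = tt , refl
  suffixNest-reverses (suc (suc k)) l len sorted with splitEnds k l len
  ... | x , M , y , refl , refl =
    let open SortedEnds (sortedEnds x M y sorted) in
    suffix-reverses (suffixNest-reverses k M refl sortedM)
      (subst (λ m → x ∷ reverse M ++ [ y ] ─[ b m ]→ y ∷ reverse M ++ [ x ]) (length-reverse M)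
        (swaps x (reverse M) y x<y (All-reverse M x<M) (All-reverse M M<y)))

reverse-palindrome : ∀ (L : List ℕ) z → reverse (L ++ z ∷ reverse L) ≡ L ++ z ∷ reverse L
reverse-palindrome L z = begin
  reverse (L ++ z ∷ reverse L)          ≡⟨ reverse-++ L (z ∷ reverse L) ⟩
  reverse (z ∷ reverse L) ++ reverse L  ≡⟨ cong (_++ reverse L) (unfold-reverse z (reverse L)) ⟩
  (reverse (reverse L) ++ [ z ]) ++ reverse L ≡⟨ cong (λ A → (A ++ [ z ]) ++ reverse L) (reverse-involutive L) ⟩
  (L ++ [ z ]) ++ reverse L             ≡⟨ ++-assoc L [ z ] (reverse L) ⟩
  L ++ z ∷ reverse L                    ∎
  where open ≡-Reasoning

peak-palindrome : ∀ k → peak k ≡ ascRun 1 k ++ suc k ∷ reverse (ascRun 1 k)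
peak-palindrome k = trans (cong₂ _++_ (ascRun-∷ʳ 1 k) (sym (reverse-ascRun k))) (++-assoc (ascRun 1 k) [ suc k ] _)

valley-palindrome : ∀ k → valley k ≡ reverse (ascRun 2 k) ++ 1 ∷ reverse (reverse (ascRun 2 k))
valley-palindrome k = begin
  descRun (suc k) ++ ascRun 2 k                     ≡⟨ cong (_++ ascRun 2 k) (descRun-∷ʳ k) ⟩
  (shift (descRun k) ++ [ 1 ]) ++ ascRun 2 k        ≡⟨ ++-assoc (shift (descRun k)) [ 1 ] (ascRun 2 k) ⟩
  shift (descRun k) ++ 1 ∷ ascRun 2 k
    ≡⟨ cong₂ (λ A B → A ++ 1 ∷ B) shift-descRun (sym (reverse-involutive (ascRun 2 k))) ⟩
  reverse (ascRun 2 k) ++ 1 ∷ reverse (reverse (ascRun 2 k)) ∎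
  where
  open ≡-Reasoning
  shift-descRun : shift (descRun k) ≡ reverse (ascRun 2 k)
  shift-descRun = trans (cong shift (sym (reverse-ascRun k)))
                        (trans (reverse-map suc (ascRun 1 k)) (cong reverse (shift-ascRun 1 k)))

reverse-peak : ∀ k → reverse (peak k) ≡ peak k
reverse-peak k = trans (cong reverse (peak-palindrome k)) (trans (reverse-palindrome _ _) (sym (peak-palindrome k)))

reverse-valley : ∀ k → reverse (valley k) ≡ valley k
reverse-valley k = trans (cong reverse (valley-palindrome k)) (trans (reverse-palindrome _ _) (sym (valley-palindrome k)))

reverse-prefixNest : ∀ {b} → (∀ k → reverse (b k) ≡ b k) → ∀ n → reverse (prefixNest b n) ≡ suffixNest b n
reverse-prefixNest         palin zero          = refl
reverse-prefixNest         palin (suc zero)    = refl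
reverse-prefixNest {b = b} palin (suc (suc k)) = begin
  reverse (b k ++ shift (prefixNest b k))             ≡⟨ reverse-++ (b k) (shift (prefixNest b k)) ⟩
  reverse (shift (prefixNest b k)) ++ reverse (b k)   ≡⟨ cong₂ _++_ (sym (reverse-map suc (prefixNest b k))) (palin k) ⟩
  shift (reverse (prefixNest b k)) ++ b k             ≡⟨ cong (λ A → shift A ++ b k) (reverse-prefixNest palin k) ⟩
  shift (suffixNest b k) ++ b k                       ∎
  where open ≡-Reasoning

reverse-suffixNest : ∀ {b} → (∀ k → reverse (b k) ≡ b k) → ∀ n → reverse (suffixNest b n) ≡ prefixNest b n
reverse-suffixNest {b = b} palin n =
  trans (cong reverse (sym (reverse-prefixNest palin n))) (reverse-involutive (prefixNest b n))

module _ {b : ℕ → List ℕ} (swaps : SwapsEnds b) where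

  prefixNest-IsWord : ∀ k → IsWord k (prefixNest b k)
  prefixNest-IsWord k = Ascending⇒IsWord k (ascRun 1 k) _ (length-ascRun 1 k)
    (ascending (prefixNest-reverses swaps k (ascRun 1 k) (length-ascRun 1 k) (ascRun-sorted 1 k)))

  suffixNest-IsWord : ∀ k → IsWord k (suffixNest b k)
  suffixNest-IsWord k = Ascending⇒IsWord k (ascRun 1 k) _ (length-ascRun 1 k)
    (ascending (suffixNest-reverses swaps k (ascRun 1 k) (length-ascRun 1 k) (ascRun-sorted 1 k)))

  suffixNest-head : (∀ k → b k ≢ []) → ∀ j →
    Σ[ h ∈ ℕ ] Σ[ t ∈ List ℕ ] suffixNest b (4 + j) ≡ suc h ∷ t × 1 ≤ h × h < 2 + j
  suffixNest-head nonempty j = go (suffixNest b (2 + j)) (suffixNest-IsWord (2 + j)) (++-nonempty (nonempty j))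
    where
    ++-nonempty : b j ≢ [] → suffixNest b (2 + j) ≢ []
    ++-nonempty ne e = ne (++-conicalʳ (shift (suffixNest b j)) (b j) e)
    go : ∀ w → IsWord (2 + j) w → w ≢ [] →
      Σ[ h ∈ ℕ ] Σ[ t ∈ List ℕ ] shift w ++ b (2 + j) ≡ suc h ∷ t × 1 ≤ h × h < 2 + j
    go []      _         ne = ⊥-elim (ne refl)
    go (h ∷ w) (hw ∷ _) _  = h , _ , refl , hw

Walk-peak : ∀ k → Walk (0 ∷ peak k)
Walk-peak k = subst (λ A → Walk (0 ∷ A ++ descRun k)) (sym (ascRun-∷ʳ 1 k))
  (Linked-glue (0 ∷ ascRun 1 k) (suc k) (descRun k)
    (subst (λ A → Walk (0 ∷ A)) (ascRun-∷ʳ 1 k) (Walk-ascRun 0 (suc k))) (Walk-descRun k))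

Walk-valley : ∀ k → Walk (2 + k ∷ valley k)
Walk-valley k = subst (λ A → Walk (2 + k ∷ A ++ ascRun 2 k)) (sym (descRun-∷ʳ k))
  (Linked-glue (2 + k ∷ shift (descRun k)) 1 (ascRun 2 k)
    (subst (λ A → Walk (2 + k ∷ A)) (descRun-∷ʳ k) (Walk-descRun (suc k))) (Walk-ascRun 1 k))

Walk-prefixNest : ∀ {b} (u : ℕ → ℕ) → (∀ k → Walk (u (2 + k) ∷ b k)) →
  (∀ k → Σ[ B ∈ List ℕ ] b k ≡ B ++ [ suc (u k) ]) → ∀ n → Walk (u n ∷ prefixNest b n)
Walk-prefixNest u _    _      zero          = [-]
Walk-prefixNest u _    _      (suc zero)    = [-]
Walk-prefixNest {b} u walk closes (suc (suc k)) with closes k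
... | B , b≡ =
  subst (λ C → Walk (u (2 + k) ∷ C ++ shift (prefixNest b k))) (sym b≡)
    (Linked-glue (u (2 + k) ∷ B) (suc (u k)) (shift (prefixNest b k))
      (subst (λ C → Walk (u (2 + k) ∷ C)) b≡ (walk k)) (Walk-shift⁺ (Walk-prefixNest u walk closes k)))

-- Classification of ascending walks that reverse a sorted list

-- For k = n these are a, its reverse, its complement and its reverse complement (symmetries⇔Family).
Family : ℕ → List ℕ → Set
Family k s = s ≡ prefixNest peak k ⊎ s ≡ suffixNest peak k ⊎ s ≡ prefixNest valley k ⊎ s ≡ suffixNest valley k

Family-reverse : ∀ k s → Family k s → Family k (reverse s)
Family-reverse k _ (inj₁ refl)               = inj₂ (inj₁ (reverse-prefixNest reverse-peak k))
Family-reverse k _ (inj₂ (inj₁ refl))        = inj₁ (reverse-suffixNest reverse-peak k)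
Family-reverse k _ (inj₂ (inj₂ (inj₁ refl))) = inj₂ (inj₂ (inj₂ (reverse-prefixNest reverse-valley k)))
Family-reverse k _ (inj₂ (inj₂ (inj₂ refl))) = inj₂ (inj₂ (inj₁ (reverse-suffixNest reverse-valley k)))

Starts : ℕ → List ℕ → Set
Starts c []      = ⊤
Starts c (h ∷ _) = h ≡ c

private
  collapse : ∀ {A : Set} → A ⊎ A ⊎ A ⊎ A → A
  collapse (inj₁ a)               = a
  collapse (inj₂ (inj₁ a))        = a
  collapse (inj₂ (inj₂ (inj₁ a))) = a
  collapse (inj₂ (inj₂ (inj₂ a))) = a

  peak-head : ∀ j → Σ[ h ∈ ℕ ] Σ[ t ∈ List ℕ ] suffixNest peak (4 + j) ≡ suc h ∷ t × 1 ≤ h × h < 2 + j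
  peak-head = suffixNest-head peak-swapsEnds (λ _ ())

  valley-head : ∀ j → Σ[ h ∈ ℕ ] Σ[ t ∈ List ℕ ] suffixNest valley (4 + j) ≡ suc h ∷ t × 1 ≤ h × h < 2 + j
  valley-head = suffixNest-head valley-swapsEnds (λ _ ())

  starts-inside : ∀ {c j Y h t} → Y ≡ suc h ∷ t → Starts c Y → 1 ≤ h → h < 2 + j → c ≡ 1 ⊎ c ≡ 3 + j → ⊥
  starts-inside refl refl ()  _   (inj₁ refl)
  starts-inside refl refl _   h<  (inj₂ refl) = <-irrefl refl h<

identify-peak : ∀ k Y → Family k Y → Starts 1 Y → Y ≡ prefixNest peak k
identify-peak k                   Y (inj₁ e)                  _  = e
identify-peak 0                   Y f                         _  = collapse f
identify-peak 1                   Y f                         _  = collapse f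
identify-peak 2                   Y f                         _  = collapse f
identify-peak 3                   Y (inj₂ (inj₁ e))           _  = e
identify-peak 3                   Y (inj₂ (inj₂ (inj₁ refl))) ()
identify-peak 3                   Y (inj₂ (inj₂ (inj₂ refl))) ()
identify-peak (2+ (2+ j)) Y (inj₂ (inj₁ refl)) st =
  let h , t , eq , 1≤h , h< = peak-head j in ⊥-elim (starts-inside eq st 1≤h h< (inj₁ refl))
identify-peak (2+ (2+ j)) Y (inj₂ (inj₂ (inj₁ refl))) ()
identify-peak (2+ (2+ j)) Y (inj₂ (inj₂ (inj₂ refl))) st =
  let h , t , eq , 1≤h , h< = valley-head j in ⊥-elim (starts-inside eq st 1≤h h< (inj₁ refl))

identify-valley : ∀ k Y → Family k Y → Starts (pred k) Y → Y ≡ prefixNest valley k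
identify-valley k                   Y (inj₂ (inj₂ (inj₁ e)))    _  = e
identify-valley 0                   Y f                         _  = collapse f
identify-valley 1                   Y f                         _  = collapse f
identify-valley 2                   Y f                         _  = collapse f
identify-valley 3                   Y (inj₁ refl)               ()
identify-valley 3                   Y (inj₂ (inj₁ refl))        ()
identify-valley 3                   Y (inj₂ (inj₂ (inj₂ e)))    _  = e
identify-valley (2+ (2+ j)) Y (inj₁ refl) ()
identify-valley (2+ (2+ j)) Y (inj₂ (inj₁ refl)) st =
  let h , t , eq , 1≤h , h< = peak-head j in ⊥-elim (starts-inside eq st 1≤h h< (inj₂ refl))
identify-valley (2+ (2+ j)) Y (inj₂ (inj₂ (inj₂ refl))) st =
  let h , t , eq , 1≤h , h< = valley-head j in ⊥-elim (starts-inside eq st 1≤h h< (inj₂ refl))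

interior : ∀ x N y r Z → x < y → All (x <_) N → All (_< y) N →
  y ∷ N ++ [ x ] ─[ r ]→ y ∷ Z ++ [ x ] → Σ[ Y ∈ List ℕ ] r ≡ shift Y × N ─[ Y ]→ Z
interior x N y []                 Z _   _   _   (_ , eq)          = [] , refl , (tt , ∷ʳ-injectiveˡ N Z (∷-injectiveʳ eq))
interior x N y (zero ∷ r)         Z _   _   _   ((() , _) , _)
interior x N y (suc zero ∷ r)     Z x<y _   N<y ((asc , _) , _)   =
  ⊥-elim (¬ascentAt-after-max y [] (N ++ [ x ]) (All.∷ʳ⁺ N<y x<y) asc)
interior x N y (suc (suc h) ∷ r) Z x<y x<N N<y ((asc , ascs) , eq) =
  let inside = ascentAt-∷ʳ-inside (suc h) N x asc
                 (λ e → ¬ascentAt-before-min x N [] x<N (subst (λ m → AscentAt m (N ++ [ x ])) e asc))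
      moved  = cong (y ∷_) (swapPos-++ˡ (suc h) N [ x ] inside)
      Y , r≡ , pathY = interior x (swapPos (suc h) N) y r Z x<y (All-swapPos (suc h) N x<N) (All-swapPos (suc h) N N<y)
                         (─→-cong moved refl (ascs , eq))
  in suc h ∷ Y , cong (suc (suc h) ∷_) r≡ , ─→-∷ (ascentAt-++ˡ⁻ (suc h) N [ x ] inside asc) pathY

record Opening (k : ℕ) (M s : List ℕ) : Set where
  field
    X rest     : List ℕ
    letter     : ℕ
    s≡         : s ≡ shift X ++ letter ∷ rest
    ascX       : Ascending M X
    letter-end : letter ≡ 1 ⊎ letter ≡ suc k

opening : ∀ x N y s Z → x < y → x ∷ N ++ [ y ] ─[ s ]→ y ∷ Z → Opening (length N) N s
opening x N y s Z x<y = go N s refl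
  where
  go : ∀ {k} N s → length N ≡ k → x ∷ N ++ [ y ] ─[ s ]→ y ∷ Z → Opening k N s
  go N []                 _    (_ , eq)       = ⊥-elim (<-irrefl (∷-injectiveˡ eq) x<y)
  go N (zero ∷ s)         _    ((() , _) , _)
  go N (suc zero ∷ s)     _    _              =
    record { X = [] ; rest = s ; letter = 1 ; s≡ = refl ; ascX = tt ; letter-end = inj₁ refl }
  go N (suc (suc j) ∷ s) refl ((asc , ascs) , eq) with suc j ≟ length N
  ... | yes j≡ = record { X = [] ; rest = s ; letter = suc (suc j) ; s≡ = refl ; ascX = tt ; letter-end = inj₂ (cong suc j≡) }
  ... | no j≢ =
    let inside = ascentAt-∷ʳ-inside (suc j) N y asc j≢
        moved  = cong (x ∷_) (swapPos-++ˡ (suc j) N [ y ] inside)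
        open Opening (go (swapPos (suc j) N) s (length-swapPos (suc j) N) (─→-cong moved refl (ascs , eq)))
    in record { X = suc j ∷ X ; rest = rest ; letter = letter ; s≡ = cong (suc (suc j) ∷_) s≡
              ; ascX = ascentAt-++ˡ⁻ (suc j) N [ y ] inside asc , ascX ; letter-end = letter-end }

peak-forced : ∀ x N y r Z → x < y → All (x <_) N → All (_< y) N → Walk r → HeadAtMost 1 r →
  x ∷ N ++ [ y ] ─[ r ]→ y ∷ Z ++ [ x ] → Σ[ Y ∈ List ℕ ] r ≡ peak (length N) ++ shift Y × N ─[ Y ]→ Z
peak-forced x N y r Z x<y x<N N<y walk hd path
  with ascRun-forced [] x (N ++ [ y ]) r (y ∷ Z) [] (All.∷ʳ⁺ x<N x<y) walk hd path
... | r₁ , refl , path₁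
  with Walk-after-ascRun 1 (length N) r₁ (subst (λ m → Walk (ascRun 1 m ++ r₁)) (length-∷ʳ N y) walk)
... | walk₁
  with descRun-forced N y [ x ] r₁ (Z ++ [ x ]) N<y (x<y ∷ []) (Linked.tail walk₁)
         (Walk⇒HeadAtLeast (length N) r₁ walk₁) (─→-cong (++-assoc N [ y ] [ x ]) refl path₁)
... | r₂ , refl , path₂
  with interior x N y r₂ Z x<y x<N N<y path₂
... | Y , refl , pathY =
  Y , trans (cong (λ m → ascRun 1 m ++ _) (length-∷ʳ N y)) (sym (++-assoc (ascRun 1 (suc (length N))) _ (shift Y))) , pathY

valley-forced : ∀ x N y r Z → x < y → All (x <_) N → All (_< y) N → Walk r → HeadAtLeast (suc (length N)) r →
  x ∷ N ++ [ y ] ─[ r ]→ y ∷ Z ++ [ x ] → Σ[ Y ∈ List ℕ ] r ≡ valley (length N) ++ shift Y × N ─[ Y ]→ Z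
valley-forced x N y r Z x<y x<N N<y walk hd path
  with descRun-forced (x ∷ N) y [] r (Z ++ [ x ]) (x<y ∷ N<y) [] walk hd path
... | r₁ , refl , path₁
  with Walk-after-descRun (length N) r₁ walk
... | walk₁
  with ascRun-forced [ y ] x N r₁ (y ∷ Z) (x<y ∷ []) x<N (Linked.tail walk₁) (Walk⇒HeadAtMost 1 r₁ walk₁)
         (─→-cong (cong (λ t → y ∷ x ∷ t) (++-identityʳ N)) refl path₁)
... | r₂ , refl , path₂
  with interior x N y r₂ Z x<y x<N N<y path₂
... | Y , refl , pathY = Y , sym (++-assoc (descRun (suc (length N))) _ (shift Y)) , pathY

-- What the junction argument needs about the block b k: its first and last letter (edge), and the
-- only letter c of a word on M that, shifted to suc c, can stand next to the edge in a walk (inner).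
record Block (b : ℕ → List ℕ) (k : ℕ) : Set where
  field
    edge     : ℕ
    inner    : ℕ
    opens    : Σ[ B ∈ List ℕ ] b k ≡ edge ∷ B
    closes   : Σ[ B ∈ List ℕ ] b k ≡ B ++ [ edge ]
    junction : ∀ c → c < k → Adjacent edge (suc c) → c ≡ inner
    identify : ∀ Y → Family k Y → Starts inner Y → Y ≡ prefixNest b k

peak-block : ∀ k → Block peak k
peak-block k = record
  { edge = 1 ; inner = 1
  ; opens = ascRun 2 k ++ descRun k , refl
  ; closes = peak-closes k
  ; junction = λ { c _ (inj₁ e) → sym (suc-injective e) }
  ; identify = identify-peak k }

valley-block : ∀ k → Block valley k
valley-block k = record
  { edge = suc k ; inner = pred k
  ; opens = descRun k ++ ascRun 2 k , refl
  ; closes = valley-closes k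
  ; junction = junction
  ; identify = identify-valley k }
  where
  junction : ∀ c → c < k → Adjacent (suc k) (suc c) → c ≡ pred k
  junction c c<k (inj₁ e) = ⊥-elim (<-asym c<k (subst (k <_) (suc-injective e) (n<1+n k)))
  junction c c<k (inj₂ e) = cong pred (suc-injective e)

module _ {b : ℕ → List ℕ} {k : ℕ} (blk : Block b k) where
  open Block blk

  junction-before : ∀ X z R → z < k → Walk (shift (X ++ [ z ]) ++ b k ++ R) → z ≡ inner
  junction-before X z R z<k walk =
    junction z z<k (Adjacent-sym (Walk-between (shift X) (suc z) edge (proj₁ opens ++ R)
      (subst Walk (cong₂ _++_ (map-++ suc X [ z ]) (cong (_++ R) (proj₂ opens))) walk)))

  junction-after : ∀ L y Y → y < k → Walk (L ++ b k ++ shift (y ∷ Y)) → y ≡ inner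
  junction-after L y Y y<k walk =
    junction y y<k (Walk-between (L ++ B) edge (suc y) (shift Y) (subst Walk reassociate walk))
    where
    B = proj₁ closes
    R = shift (y ∷ Y)
    reassociate : L ++ b k ++ R ≡ ((L ++ B) ++ [ edge ]) ++ R
    reassociate = trans (cong (λ C → L ++ C ++ R) (proj₂ closes))
                  (trans (sym (++-assoc L (B ++ [ edge ]) R)) (cong (_++ R) (sym (++-assoc L B [ edge ]))))

ReversingWalksInFamily : ℕ → List ℕ → Set
ReversingWalksInFamily k M = ∀ t → Walk t → M ─[ t ]→ reverse M → Family k t

module _ {b : ℕ → List ℕ} (palindromic : ∀ k → reverse (b k) ≡ b k) where

  split-word-is-nested : ∀ {k M N} X Y → Block b k → length M ≡ k → ReversingWalksInFamily k M →
    Walk (shift X ++ b k ++ shift Y) → M ─[ X ]→ N → N ─[ Y ]→ reverse M →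
    shift X ++ b k ++ shift Y ≡ prefixNest b (2 + k) ⊎ shift X ++ b k ++ shift Y ≡ suffixNest b (2 + k)
  split-word-is-nested {k} {M} X Y blk refl ih walk pX pY with reverseView X | Y | pX | pY
  ... | [] | Y | (_ , refl) | pY =
    inj₁ (cong (λ Z → b k ++ shift Z) (identify Y (ih Y (Walk-shift⁻ (Linked-++⁻ʳ (b k) walk)) pY) (starts Y pY walk)))
    where
    open Block blk
    starts : ∀ Y → M ─[ Y ]→ reverse M → Walk (b k ++ shift Y) → Starts inner Y
    starts []      _  _    = tt
    starts (y ∷ Y) pY walk with path-IsWord (y ∷ Y) pY
    ... | (_ , y<k) ∷ _ = junction-after blk [] y Y y<k walk
  ... | X ∶ _ ∶ʳ z | [] | pX | (_ , refl) =
    inj₂ (trans (cong (shift (X ++ [ z ]) ++_) (++-identityʳ (b k)))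
      (cong (λ Z → shift Z ++ b k) (identify-reversed (ih (X ++ [ z ]) walkX pX) starts)))
    where
    open Block blk
    walkX = Walk-shift⁻ (Linked-++⁻ˡ (shift (X ++ [ z ])) walk)
    starts : Starts inner (reverse (X ++ [ z ]))
    starts = subst (Starts inner) (sym (reverse-++ X [ z ]))
               (junction-before blk X z [] (IsWord-last X z (path-IsWord (X ++ [ z ]) pX)) walk)
    identify-reversed : Family k (X ++ [ z ]) → Starts inner (reverse (X ++ [ z ])) → X ++ [ z ] ≡ suffixNest b k
    identify-reversed fam st = begin
      X ++ [ z ]                      ≡⟨ reverse-involutive (X ++ [ z ]) ⟨
      reverse (reverse (X ++ [ z ]))  ≡⟨ cong reverse (identify _ (Family-reverse k (X ++ [ z ]) fam) st) ⟩
      reverse (prefixNest b k)        ≡⟨ reverse-prefixNest palindromic k ⟩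
      suffixNest b k                  ∎
      where open ≡-Reasoning
  ... | X ∶ _ ∶ʳ z | y ∷ Y | pX | pY with path-IsWord (y ∷ Y) pY
  ...   | (_ , y<N) ∷ _ = ⊥-elim (last-letter-not-ascent X z pX (subst (λ c → AscentAt c _) y≡z (proj₁ (ascending pY))))
    where
    y≡z : y ≡ z
    y≡z = trans (junction-after blk (shift (X ++ [ z ])) y Y (subst (y <_) (length-path pX) y<N) walk)
                (sym (junction-before blk X z (shift (y ∷ Y)) (IsWord-last X z (path-IsWord (X ++ [ z ]) pX)) walk))

classify-step : ∀ x M y → SortedEnds x M y →
  ReversingWalksInFamily (length M) M → ReversingWalksInFamily (2 + length M) (x ∷ M ++ [ y ])
classify-step x M y ends ih s walk path = go (opening x M y s (reverse M ++ [ x ]) x<y path′)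
  where
  open SortedEnds ends
  path′ : x ∷ M ++ [ y ] ─[ s ]→ y ∷ reverse M ++ [ x ]
  path′ = ─→-cong refl (reverse-ends x M y) path
  go : Opening (length M) M s → Family (2 + length M) s
  go o = branch letter-end
    where
    open Opening o
    N = M · X
    pX : M ─[ X ]→ N
    pX = ascX , refl
    lenN : length N ≡ length M
    lenN = length-path pX
    x<N = All-· M X x<M
    N<y = All-· M X M<y
    restPath : x ∷ N ++ [ y ] ─[ letter ∷ rest ]→ y ∷ reverse M ++ [ x ]
    restPath = ─→-after (─→-shift x X (─→-padRight [ y ] X pX)) (subst (λ t → _ ─[ t ]→ _) s≡ path′)
    restWalk : Walk (letter ∷ rest)
    restWalk = Linked-++⁻ʳ (shift X) (subst Walk s≡ walk)
    via-block : ∀ b {Y} → letter ∷ rest ≡ b (length N) ++ shift Y → s ≡ shift X ++ b (length M) ++ shift Y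
    via-block b {Y} eq = trans s≡ (cong (shift X ++_) (trans eq (cong (λ m → b m ++ shift Y) lenN)))
    conclude : ∀ {b} → (∀ k → reverse (b k) ≡ b k) → Block b (length M) →
      (∀ {t} → t ≡ prefixNest b (2 + length M) ⊎ t ≡ suffixNest b (2 + length M) → Family (2 + length M) t) →
      ∀ Y → s ≡ shift X ++ b (length M) ++ shift Y → N ─[ Y ]→ reverse M → Family (2 + length M) s
    conclude palindromic blk embed Y s≡′ pY =
      subst (Family _) (sym s≡′) (embed (split-word-is-nested palindromic X Y blk refl ih (subst Walk s≡′ walk) pX pY))
    branch : letter ≡ 1 ⊎ letter ≡ suc (length M) → Family (2 + length M) s
    branch (inj₁ e) =
      let Y , eq , pY = peak-forced x N y (letter ∷ rest) (reverse M) x<y x<N N<y restWalk (≤-reflexive e) restPath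
      in conclude reverse-peak (peak-block (length M)) [ inj₁ , inj₂ ∘ inj₁ ]′ Y (via-block peak eq) pY
    branch (inj₂ e) =
      let Y , eq , pY = valley-forced x N y (letter ∷ rest) (reverse M) x<y x<N N<y restWalk
                          (≤-trans (s≤s (≤-reflexive lenN)) (≤-reflexive (sym e))) restPath
      in conclude reverse-valley (valley-block (length M)) [ inj₂ ∘ inj₂ ∘ inj₁ , inj₂ ∘ inj₂ ∘ inj₂ ]′
           Y (via-block valley eq) pY

classify : ∀ n l → length l ≡ n → Sorted l → ReversingWalksInFamily n l
classify zero          []       refl _ []      _ _               = inj₁ refl
classify zero          []       refl _ (h ∷ _) _ ((asc , _) , _) = ⊥-elim (n≮0 (proj₂ (ascentAt⇒bounded h [] asc)))
classify (suc zero)    (x ∷ []) refl _ []      _ _               = inj₁ refl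
classify (suc zero)    (x ∷ []) refl _ (h ∷ _) _ ((asc , _) , _) =
  let 1≤h , h<1 = ascentAt⇒bounded h [ x ] asc in ⊥-elim (<-irrefl refl (≤-<-trans 1≤h h<1))
classify (suc (suc k)) l        len sorted with splitEnds k l len
... | x , M , y , refl , lenM =
  let ends = sortedEnds x M y sorted in
  subst (λ m → ReversingWalksInFamily (2 + m) (x ∷ M ++ [ y ])) lenM
    (classify-step x M y ends (subst (λ m → ReversingWalksInFamily m M) (sym lenM) (classify k M lenM (SortedEnds.sortedM ends))))

applyUpTo≡ascRun : ∀ f i l → (∀ j → f j ≡ i + j) → applyUpTo f l ≡ ascRun i l
applyUpTo≡ascRun f i zero    _ = refl
applyUpTo≡ascRun f i (suc l) e =
  cong₂ _∷_ (trans (e 0) (+-identityʳ i)) (applyUpTo≡ascRun (f ∘ suc) (suc i) l (λ j → trans (e (suc j)) (+-suc i j)))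

map-+-upTo : ∀ i l → map (i +_) (upTo l) ≡ ascRun i l
map-+-upTo i l = trans (map-upTo (i +_) l) (applyUpTo≡ascRun (i +_) i l (λ _ → refl))

hairpin : ℕ → ℕ → List ℕ
hairpin i l = ascRun i l ++ drop 1 (reverse (ascRun i l))

blockB≡hairpin : ∀ n k → blockB n k ≡ hairpin k (suc ((n ∸ k) ∸ k))
blockB≡hairpin n k = cong (λ L → L ++ drop 1 (reverse L)) (map-+-upTo k (suc ((n ∸ k) ∸ k)))

shift-hairpin : ∀ i l → shift (hairpin i l) ≡ hairpin (suc i) l
shift-hairpin i l = begin
  shift (ascRun i l ++ drop 1 (reverse (ascRun i l)))           ≡⟨ map-++ suc (ascRun i l) _ ⟩
  shift (ascRun i l) ++ shift (drop 1 (reverse (ascRun i l)))   ≡⟨ cong (shift (ascRun i l) ++_) shift-tail ⟩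
  shift (ascRun i l) ++ drop 1 (reverse (shift (ascRun i l)))   ≡⟨ cong (λ L → L ++ drop 1 (reverse L)) (shift-ascRun i l) ⟩
  hairpin (suc i) l                                             ∎
  where
  open ≡-Reasoning
  shift-tail : shift (drop 1 (reverse (ascRun i l))) ≡ drop 1 (reverse (shift (ascRun i l)))
  shift-tail = trans (sym (drop-map 1 (reverse (ascRun i l)))) (cong (drop 1) (reverse-map suc (ascRun i l)))

blockB-outer : ∀ k → blockB (2 + k) 1 ≡ peak k
blockB-outer k = trans (blockB≡hairpin (2 + k) 1) (cong (λ L → ascRun 1 (suc k) ++ drop 1 L) (reverse-ascRun (suc k)))

blockB-inner : ∀ n i → blockB (2 + n) (2 + i) ≡ shift (blockB n (suc i))
blockB-inner n i = begin
  blockB (2 + n) (2 + i)                               ≡⟨ blockB≡hairpin (2 + n) (2 + i) ⟩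
  hairpin (2 + i) (suc ((n ∸ i) ∸ (2 + i)))            ≡⟨ cong (λ m → hairpin (2 + i) (suc m)) width ⟩
  hairpin (2 + i) (suc ((n ∸ suc i) ∸ suc i))          ≡⟨ shift-hairpin (suc i) (suc ((n ∸ suc i) ∸ suc i)) ⟨
  shift (hairpin (suc i) (suc ((n ∸ suc i) ∸ suc i)))  ≡⟨ cong shift (blockB≡hairpin n (suc i)) ⟨
  shift (blockB n (suc i))                             ∎
  where
  open ≡-Reasoning
  width : (n ∸ i) ∸ (2 + i) ≡ (n ∸ suc i) ∸ suc i
  width = trans (∸-+-assoc n i (2 + i)) (trans (cong (n ∸_) (+-suc i (suc i))) (sym (∸-+-assoc n (suc i) (suc i))))

wordA-step : ∀ k → wordA (2 + k) ≡ peak k ++ shift (wordA k)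
wordA-step k = begin
  concat (map (blockB (2 + k)) (map suc (upTo ((2 + k) / 2))))
    ≡⟨ cong (λ m → concat (map (blockB (2 + k)) (map suc (upTo m)))) (m/n≡1+[m∸n]/n {2 + k} {2} (s≤s (s≤s z≤n))) ⟩
  blockB (2 + k) 1 ++ concat (map (blockB (2 + k)) (map suc (applyUpTo suc (k / 2))))
    ≡⟨ cong₂ (λ B U → B ++ concat (map (blockB (2 + k)) (map suc U))) (blockB-outer k) (sym (map-upTo suc (k / 2))) ⟩
  peak k ++ concat (map (blockB (2 + k)) (map suc (map suc (upTo (k / 2)))))
    ≡⟨ cong (peak k ++_) (inner (upTo (k / 2))) ⟩
  peak k ++ shift (wordA k) ∎
  where
  open ≡-Reasoning
  inner : ∀ L → concat (map (blockB (2 + k)) (map suc (map suc L))) ≡ shift (concat (map (blockB k) (map suc L)))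
  inner []      = refl
  inner (i ∷ L) = trans (cong₂ _++_ (blockB-inner k i) (inner L)) (sym (map-++ suc (blockB k (suc i)) _))

wordA≡prefixNest : ∀ n → wordA n ≡ prefixNest peak n
wordA≡prefixNest zero          = refl
wordA≡prefixNest (suc zero)    = refl
wordA≡prefixNest (suc (suc k)) = trans (wordA-step k) (cong (λ W → peak k ++ shift W) (wordA≡prefixNest k))

complement-ascRun : ∀ i l → map ((i + l) ∸_) (ascRun i l) ≡ descRun l
complement-ascRun i zero    = refl
complement-ascRun i (suc l) = cong₂ _∷_ (m+n∸m≡n i (suc l))
  (trans (cong (λ c → map (c ∸_) (ascRun (suc i) l)) (+-suc i l)) (complement-ascRun (suc i) l))

complement-descRun : ∀ c l → map ((c + l) ∸_) (descRun l) ≡ ascRun c l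
complement-descRun c zero    = refl
complement-descRun c (suc l) = cong₂ _∷_ (m+n∸n≡m c (suc l))
  (trans (cong (λ d → map (d ∸_) (descRun l)) (+-suc c l)) (complement-descRun (suc c) l))

complement-peak : ∀ k → map ((2 + k) ∸_) (peak k) ≡ valley k
complement-peak k = trans (map-++ ((2 + k) ∸_) (ascRun 1 (suc k)) (descRun k))
                          (cong₂ _++_ (complement-ascRun 1 (suc k)) (complement-descRun 2 k))

complement-shift : ∀ k L → All (_≤ k) L → map ((2 + k) ∸_) (shift L) ≡ shift (map (k ∸_) L)
complement-shift k []      _          = refl
complement-shift k (i ∷ L) (i≤k ∷ L≤k) = cong₂ _∷_ (+-∸-assoc 1 i≤k) (complement-shift k L L≤k)

complement-prefixNest : ∀ n → complementW n (prefixNest peak n) ≡ prefixNest valley n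
complement-prefixNest zero          = refl
complement-prefixNest (suc zero)    = refl
complement-prefixNest (suc (suc k)) = begin
  map ((2 + k) ∸_) (peak k ++ shift (prefixNest peak k))                  ≡⟨ map-++ ((2 + k) ∸_) (peak k) _ ⟩
  map ((2 + k) ∸_) (peak k) ++ map ((2 + k) ∸_) (shift (prefixNest peak k))
    ≡⟨ cong₂ _++_ (complement-peak k) (complement-shift k _ letters≤k) ⟩
  valley k ++ shift (complementW k (prefixNest peak k))
    ≡⟨ cong (λ W → valley k ++ shift W) (complement-prefixNest k) ⟩
  valley k ++ shift (prefixNest valley k)                                 ∎
  where
  open ≡-Reasoning
  letters≤k : All (_≤ k) (prefixNest peak k)
  letters≤k = All-map (λ bounds → <⇒≤ (proj₂ bounds)) (prefixNest-IsWord peak-swapsEnds k)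

-- Commutation classes

swapPos-comm : ∀ i j w → suc (suc i) ≤ j → swapPos i (swapPos j w) ≡ swapPos j (swapPos i w)
swapPos-comm zero          j                   w           _        = refl
swapPos-comm (suc zero)    (suc zero)          w           (s≤s ())
swapPos-comm (suc zero)    (suc (suc zero))    w           (s≤s (s≤s ()))
swapPos-comm (suc (suc i)) (suc zero)          w           (s≤s ())
swapPos-comm (suc zero)    (suc (suc (suc j))) []          _        = refl
swapPos-comm (suc zero)    (suc (suc (suc j))) (a ∷ [])    _        = refl
swapPos-comm (suc zero)    (suc (suc (suc j))) (a ∷ b ∷ w) _        = refl
swapPos-comm (suc (suc i)) (suc (suc j))       []          _        = refl
swapPos-comm (suc (suc i)) (suc (suc j))       (a ∷ w)     (s≤s le) = cong (a ∷_) (swapPos-comm (suc i) (suc j) w le)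

CommMove-· : ∀ {s t} → CommMove s t → ∀ w → w · s ≡ w · t
CommMove-· (here-lt {i} {j} xs gap) w = cong (_· xs) (sym (swapPos-comm i j w gap))
CommMove-· (here-gt {i} {j} xs gap) w = cong (_· xs) (swapPos-comm j i w gap)
CommMove-· (there x m)              w = CommMove-· m (swapPos x w)

CommMove-length : ∀ {s t} → CommMove s t → length s ≡ length t
CommMove-length (here-lt xs _) = refl
CommMove-length (here-gt xs _) = refl
CommMove-length (there x m)    = cong suc (CommMove-length m)

CommMove-All : ∀ {P : ℕ → Set} {s t} → CommMove s t → All P s → All P t
CommMove-All (here-lt xs _) (pi ∷ pj ∷ p) = pj ∷ pi ∷ p
CommMove-All (here-gt xs _) (pi ∷ pj ∷ p) = pj ∷ pi ∷ p
CommMove-All (there x m)    (px ∷ p)      = px ∷ CommMove-All m p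

CommMove-++ˡ : ∀ L {s t} → CommMove s t → CommMove (L ++ s) (L ++ t)
CommMove-++ˡ []      m = m
CommMove-++ˡ (x ∷ L) m = there x (CommMove-++ˡ L m)

CommMove-reduced : ∀ {n w s t} → CommMove s t → ReducedWordOf n w s → ReducedWordOf n w t
CommMove-reduced {n} m (word , product , shortest) =
  CommMove-All m word , trans (sym (CommMove-· m (idPerm n))) product ,
  λ t′ word′ product′ → subst (_≤ length t′) (CommMove-length m) (shortest t′ word′ product′)

Walk⇒¬CommMove : ∀ {s t} → Walk s → ¬ CommMove s t
Walk⇒¬CommMove (inj₁ refl ∷ _) (here-lt xs gap) = <-irrefl refl gap
Walk⇒¬CommMove (inj₂ refl ∷ _) (here-lt xs gap) = <-irrefl refl (<-trans (n<1+n _) (<-trans (n<1+n _) gap))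
Walk⇒¬CommMove (inj₁ refl ∷ _) (here-gt xs gap) = <-irrefl refl (<-trans (n<1+n _) (<-trans (n<1+n _) gap))
Walk⇒¬CommMove (inj₂ refl ∷ _) (here-gt xs gap) = <-irrefl refl gap
Walk⇒¬CommMove walk            (there x m)      = Walk⇒¬CommMove (Linked.tail walk) m

Walk⇒OwnCommClass : ∀ n w s → Walk s → OwnCommClass n w s
Walk⇒OwnCommClass n w s walk t _ ε       = refl
Walk⇒OwnCommClass n w s walk t _ (m ◅ _) = ⊥-elim (Walk⇒¬CommMove walk m)

OwnCommClass⇒Walk : ∀ n w s → ReducedWordOf n w s → OwnCommClass n w s → Ascending (idPerm n) s → Walk s
OwnCommClass⇒Walk n w s red own asc = Linked-fromPairs s adjacent
  where
  commuting-letters-equal : ∀ L i j T → s ≡ L ++ i ∷ j ∷ T → CommMove (i ∷ j ∷ T) (j ∷ i ∷ T) → i ≡ j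
  commuting-letters-equal L i j T refl m =
    sym (∷-injectiveˡ (++-cancelˡ L _ _ (own _ (CommMove-reduced (CommMove-++ˡ L m) red) (CommMove-++ˡ L m ◅ ε))))
  adjacent : ∀ L i j T → s ≡ L ++ i ∷ j ∷ T → Adjacent i j
  adjacent L i j T s≡ with <-cmp i j
  ... | tri≈ _ refl _ with Ascending-++⁻ (idPerm n) L (i ∷ i ∷ T) (subst (Ascending (idPerm n)) s≡ asc)
  ...   | _ , (a₁ , a₂ , _) = ⊥-elim (ascentAt⇒¬ascentAt-swapPos i _ a₁ a₂)
  adjacent L i j T s≡ | tri< i<j _ _ with m≤n⇒m<n∨m≡n i<j
  ...   | inj₂ e   = inj₁ e
  ...   | inj₁ gap = ⊥-elim (<⇒≢ i<j (commuting-letters-equal L i j T s≡ (here-lt T gap)))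
  adjacent L i j T s≡ | tri> _ _ j<i with m≤n⇒m<n∨m≡n j<i
  ...   | inj₂ e   = inj₂ e
  ...   | inj₁ gap = ⊥-elim (<⇒≢ j<i (sym (commuting-letters-equal L i j T s≡ (here-gt T gap))))

Ascending⇒reduced : ∀ n w s → IsWord n s → idPerm n ─[ s ]→ w → ReducedWordOf n w s
Ascending⇒reduced n w s word (asc , arrives) =
  word , arrives , λ t _ product → Ascending⇒shortest (idPerm n) s t asc (trans product (sym arrives))

reduced⇒Ascending : ∀ n w s s₀ → IsWord n s₀ → idPerm n ─[ s₀ ]→ w → ReducedWordOf n w s → idPerm n ─[ s ]→ w
reduced⇒Ascending n w s s₀ word₀ (asc₀ , arrives₀) (_ , product , shortest) =
  shortest⇒Ascending (idPerm n) s s₀ asc₀ (trans product (sym arrives₀)) (shortest s₀ word₀ arrives₀) , product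

idPerm-sorted : ∀ n → Sorted (idPerm n)
idPerm-sorted n = subst Sorted (sym (map-+-upTo 1 n)) (ascRun-sorted 1 n)

length-idPerm : ∀ n → length (idPerm n) ≡ n
length-idPerm n = trans (cong length (map-+-upTo 1 n)) (length-ascRun 1 n)

Family⇒path : ∀ n s → Family n s → idPerm n ─[ s ]→ longElement n
Family⇒path n _ (inj₁ refl)               = prefixNest-reverses peak-swapsEnds n (idPerm n) (length-idPerm n) (idPerm-sorted n)
Family⇒path n _ (inj₂ (inj₁ refl))        = suffixNest-reverses peak-swapsEnds n (idPerm n) (length-idPerm n) (idPerm-sorted n)
Family⇒path n _ (inj₂ (inj₂ (inj₁ refl))) = prefixNest-reverses valley-swapsEnds n (idPerm n) (length-idPerm n) (idPerm-sorted n)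
Family⇒path n _ (inj₂ (inj₂ (inj₂ refl))) = suffixNest-reverses valley-swapsEnds n (idPerm n) (length-idPerm n) (idPerm-sorted n)

Family⇒IsWord : ∀ n s → Family n s → IsWord n s
Family⇒IsWord n s fam = Ascending⇒IsWord n (idPerm n) s (length-idPerm n) (ascending (Family⇒path n s fam))

Family⇒Walk : ∀ n s → Family n s → Walk s
Family⇒Walk n _ (inj₁ refl)               = Linked.tail (Walk-prefixNest (λ _ → 0) Walk-peak peak-closes n)
Family⇒Walk n _ (inj₂ (inj₁ refl))        =
  subst Walk (reverse-prefixNest reverse-peak n) (Linked-reverse Adjacent-sym _ (Family⇒Walk n _ (inj₁ refl)))
Family⇒Walk n _ (inj₂ (inj₂ (inj₁ refl))) =
  Linked.tail (Walk-prefixNest (λ k → k) Walk-valley valley-closes n)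
Family⇒Walk n _ (inj₂ (inj₂ (inj₂ refl))) =
  subst Walk (reverse-prefixNest reverse-valley n) (Linked-reverse Adjacent-sym _ (Family⇒Walk n _ (inj₂ (inj₂ (inj₁ refl)))))

symmetries⇔Family : ∀ n s →
  (s ≡ wordA n ⊎ s ≡ reverse (wordA n) ⊎ s ≡ complementW n (wordA n) ⊎ s ≡ reverseComplementW n (wordA n)) ⇔ Family n s
symmetries⇔Family n s = mk⇔
  (λ { (inj₁ e)               → inj₁ (trans e a≡)
     ; (inj₂ (inj₁ e))        → inj₂ (inj₁ (trans e aʳ≡))
     ; (inj₂ (inj₂ (inj₁ e))) → inj₂ (inj₂ (inj₁ (trans e aᶜ≡)))
     ; (inj₂ (inj₂ (inj₂ e))) → inj₂ (inj₂ (inj₂ (trans e aʳᶜ≡))) })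
  (λ { (inj₁ e)               → inj₁ (trans e (sym a≡))
     ; (inj₂ (inj₁ e))        → inj₂ (inj₁ (trans e (sym aʳ≡)))
     ; (inj₂ (inj₂ (inj₁ e))) → inj₂ (inj₂ (inj₁ (trans e (sym aᶜ≡))))
     ; (inj₂ (inj₂ (inj₂ e))) → inj₂ (inj₂ (inj₂ (trans e (sym aʳᶜ≡)))) })
  where
  a≡ : wordA n ≡ prefixNest peak n
  a≡ = wordA≡prefixNest n
  aʳ≡ : reverse (wordA n) ≡ suffixNest peak n
  aʳ≡ = trans (cong reverse a≡) (reverse-prefixNest reverse-peak n)
  aᶜ≡ : complementW n (wordA n) ≡ prefixNest valley n
  aᶜ≡ = trans (cong (complementW n) a≡) (complement-prefixNest n)
  aʳᶜ≡ : reverseComplementW n (wordA n) ≡ suffixNest valley n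
  aʳᶜ≡ = trans (cong reverse aᶜ≡) (reverse-prefixNest reverse-valley n)

reduced-ownClass⇒Family : ∀ n s → ReducedWordOf n (longElement n) s → OwnCommClass n (longElement n) s → Family n s
reduced-ownClass⇒Family n s red own =
  classify n (idPerm n) (length-idPerm n) (idPerm-sorted n) s (OwnCommClass⇒Walk n _ s red own (ascending path)) path
  where
  a = prefixNest peak n
  path : idPerm n ─[ s ]→ longElement n
  path = reduced⇒Ascending n _ s a (Family⇒IsWord n a (inj₁ refl)) (Family⇒path n a (inj₁ refl)) red

Family⇒reduced-ownClass : ∀ n s → Family n s → ReducedWordOf n (longElement n) s × OwnCommClass n (longElement n) s
Family⇒reduced-ownClass n s fam =
  Ascending⇒reduced n _ s (Family⇒IsWord n s fam) (Family⇒path n s fam) , Walk⇒OwnCommClass n _ s (Family⇒Walk n s fam)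

corollary4p1 : (n : ℕ) → 1 ≤ n → (s : List ℕ) →
    (ReducedWordOf n (longElement n) s × OwnCommClass n (longElement n) s)
      ⇔ (s ≡ wordA n ⊎ s ≡ reverse (wordA n) ⊎ s ≡ complementW n (wordA n)
          ⊎ s ≡ reverseComplementW n (wordA n))
corollary4p1 n _ s = mk⇔
  (λ (red , own) → from (reduced-ownClass⇒Family n s red own))
  (λ symmetry → Family⇒reduced-ownClass n s (to symmetry))
  where open Equivalence (symmetries⇔Family n s)
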